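{- Let $p,q\geq 1$ be integers and let $G$ be a simple graph with $n$ vertices and $m$ edges. Then \[ \hom(G,S^{\circ}(p,q))\leq \hom(L(n,m),S^{\circ}(p,q)). \]
   Context: $S^{\circ}(p,q)=K_p^{\circ}\vee E_q$ is the graph consisting of a complete graph on $p$ vertices with a loop at every vertex, together with $q$ further unlooped vertices that are pairwise nonadjacent, each of the $q$ vertices being adjacent to every one of the $p$ looped vertices. A homomorphism from $G$ to a graph $H$ (possibly with loops) is a map $\phi:V(G)\to V(H)$ with $\phi(x)\phi(y)\in E(H)$ whenever $xy\in E(G)$; $\hom(G,H)$ is the number of such maps. The lexicographic order on subsets of $[n]$ is defined by $A<B$ iff $\min(A\triangle B)\in A$; the lex graph $L(n,m)$ has vertex set $[n]$ and edge set the first $m$ two-element subsets of $[n]$ in this order. -}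

module Defs where

open import Data.Nat using (ℕ; zero; suc; _+_; _<ᵇ_)
open import Data.Bool using (Bool; true; false; _∧_; _∨_; not; if_then_else_)
open import Data.Fin using (Fin; toℕ; _≟_)
open import Data.Fin.Subset using (Subset; ⁅_⁆; _∪_; ∣_∣)
open import Data.Vec using (Vec; []; _∷_)
open import Data.List using (List; []; _∷_; map; concatMap; length; filterᵇ; allFin)
open import Data.Bool.ListAction using (and)
open import Relation.Nullary.Decidable using (⌊_⌋)
open import Relation.Binary.PropositionalEquality using (_≡_)

Graph : ℕ → Set
Graph n = Fin n → Fin n → Bool

record IsSimple {n : ℕ} (E : Graph n) : Set where
  field
    sym     : ∀ i j → E i j ≡ E j i
    irrefl  : ∀ i → E i i ≡ false

edgeCount : {n : ℕ} → Graph n → ℕ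
edgeCount {n} E =
  length (filterᵇ (λ ij → E (Data.Product.proj₁ ij) (Data.Product.proj₂ ij))
    (concatMap (λ i → map (λ j → (i Data.Product., j))
       (filterᵇ (λ j → toℕ i <ᵇ toℕ j) (allFin n))) (allFin n)))
  where import Data.Product

allMaps : (n k : ℕ) → List (Fin n → Fin k)
allMaps zero    k = (λ ()) ∷ []
allMaps (suc n) k =
  concatMap (λ f → map (λ c → extend c f) (allFin k)) (allMaps n k)
  where
  extend : Fin k → (Fin n → Fin k) → Fin (suc n) → Fin k
  extend c f Fin.zero    = c
  extend c f (Fin.suc i) = f i

isHom : {n k : ℕ} → Graph n → Graph k → (Fin n → Fin k) → Bool
isHom {n} G H φ =
  and (concatMap (λ i → map (λ j → not (G i j) ∨ H (φ i) (φ j)) (allFin n)) (allFin n))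

hom : {n k : ℕ} → Graph n → Graph k → ℕ
hom {n} {k} G H = length (filterᵇ (isHom G H) (allMaps n k))

-- S°(p,q) = K°_p ∨ E_q on vertex set Fin (p + q): vertices with index < p are the
-- looped clique vertices, the remaining q vertices are the independent set.
-- u ~ v iff at least one of u, v lies in the looped clique.
Sloop : (p q : ℕ) → Graph (p + q)
Sloop p q u v = (toℕ u <ᵇ p) ∨ (toℕ v <ᵇ p)

-- Lexicographic order on subsets of [n] (as characteristic vectors, index 0 = least
-- element): A < B iff min (A △ B) ∈ A, i.e. at the first position where they differ,
-- A has true.
lex< : {n : ℕ} → Subset n → Subset n → Bool
lex< []            []            = false
lex< (true  ∷ as) (true  ∷ bs) = lex< as bs
lex< (false ∷ as) (false ∷ bs) = lex< as bs
lex< (true  ∷ as) (false ∷ bs) = true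
lex< (false ∷ as) (true  ∷ bs) = false

allSubsets : (n : ℕ) → List (Subset n)
allSubsets zero    = [] ∷ []
allSubsets (suc n) = concatMap (λ s → (true ∷ s) ∷ (false ∷ s) ∷ []) (allSubsets n)

twoSubsets : (n : ℕ) → List (Subset n)
twoSubsets n = filterᵇ (λ s → ⌊ ∣ s ∣ Data.Nat.≟ 2 ⌋) (allSubsets n)
  where import Data.Nat

lexRank : {n : ℕ} → Subset n → ℕ
lexRank {n} s = length (filterᵇ (λ t → lex< t s) (twoSubsets n))

lexGraph : (n m : ℕ) → Graph n
lexGraph n m i j =
  if ⌊ i ≟ j ⌋ then false else (lexRank (⁅ i ⁆ ∪ ⁅ j ⁆) <ᵇ m)

-- Mapping G to S°(p,q), the vertices sent to the unlooped part form an independent set, so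
-- hom(G, S°(p,q)) = Z(G) = Σ p^(n-|I|) q^|I| over the independent sets I of G.
--
-- Fix a vertex v. The Kelmans shift from u to v hands v every neighbour of u that v lacked. It keeps
-- the number of edges and does not decrease Z: after splitting off v and u, the only terms that
-- change are Z(H ∖ N(v)) + Z(H ∖ N(u)) on the rest H, which become Z(H ∖ (N(v) ∪ N(u))) +
-- Z(H ∖ (N(v) ∩ N(u))), and an independent set avoiding N(v) or N(u) avoids N(v) ∩ N(u).
-- Every shift raises the degree of v, so eventually v dominates: each edge of G - v has both ends
-- in N(v). Then G - v is G[N(v)] plus isolated vertices, Z(G) factors, and induction on the number
-- of vertices bounds it by the recursion that the lex graph satisfies with equality. That final
-- comparison rests on two facts about the lex value Λ: appending an isolated vertex is worse than
-- growing the lex graph by a vertex, and each additional edge costs at least q²p^k.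

module Submission where

open import Defs
open import Data.Nat using (ℕ; _≤_; _+_)
open import Relation.Binary.PropositionalEquality using (_≡_)

open import Data.Bool using (Bool; true; false; _∧_; _∨_; not; if_then_else_)
open import Data.Bool.ListAction using (and)
open import Data.Bool.Properties
  using ( ∧-assoc; ∧-zeroʳ; ∧-identityʳ; ∧-conicalˡ; ∧-conicalʳ; ∨-idem; ∨-identityʳ; ∨-conicalˡ; ∨-conicalʳ
        ; not-¬; ⇔→≡; ∧-commutativeMonoid; ∨-∧-booleanAlgebra )
import Data.Bool.Properties as Bool
open import Data.Empty using (⊥-elim)
open import Data.Fin using (Fin; zero; suc; toℕ)
import Data.Fin as Fin
open import Data.Fin.Properties using (toℕ-injective; toℕ<n; any?)
open import Data.Fin.Subset using (Subset; ⁅_⁆; ∣_∣; ⊥) renaming (_∪_ to _∪ˢ_)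
open import Data.Fin.Subset.Properties using (∪-identityˡ; ∪-identityʳ)
open import Data.List using (List; []; _∷_; _++_; map; concatMap; length; filterᵇ; allFin; tabulate)
open import Data.List.Properties using (map-++; map-cong; map-∘; map-tabulate)
open import Data.Nat using (zero; suc; _*_; _∸_; _^_; _<_; _⊓_; _<ᵇ_; _≡ᵇ_; z≤n; s≤s)
import Data.Nat as ℕ
open import Data.Nat.Induction using (<-rec)
open import Data.Nat.ListAction using () renaming (sum to sumᴸ)
open import Data.Nat.ListAction.Properties using () renaming (sum-++ to sumᴸ-++)
open import Data.Nat.Properties
open import Data.Nat.Tactic.RingSolver using (solve-∀)
open import Data.Product using (Σ; _×_; _,_; proj₁; proj₂)
open import Data.Sum using (_⊎_; inj₁; inj₂; [_,_]′; map₁)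
open import Data.Vec using (Vec; []; _∷_; lookup; _[_]≔_)
import Data.Vec as Vec
open import Data.Vec.Properties using (lookup∘update; lookup∘tabulate)
open import Function using (_∘_; _⇔_; mk⇔; Equivalence)
open import Relation.Binary.PropositionalEquality
  using (_≢_; refl; sym; trans; cong; cong₂; subst; subst₂; module ≡-Reasoning)
open import Relation.Nullary using (yes; no)
open import Relation.Nullary.Decidable using (⌊_⌋)

open import Algebra.Bundles using (module CommutativeMonoid)
open import Algebra.Lattice.Properties.BooleanAlgebra ∨-∧-booleanAlgebra using (deMorgan₂)
open import Algebra.Properties.CommutativeSemigroup (CommutativeMonoid.commutativeSemigroup ∧-commutativeMonoid)
  using () renaming (xy∙z≈xz∙y to ∧-rightComm)
open import Algebra.Properties.CommutativeSemigroup +-commutativeSemigroup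
  using () renaming (interchange to +-interchange)
open import Algebra.Properties.CommutativeSemigroup *-commutativeSemigroup
  using () renaming (x∙yz≈y∙xz to *-leftComm)
open import Algebra.Properties.Semiring.Sum +-*-semiring using (sum; sum-cong-≗; ∑-distrib-+)

module _ {a b : Bool} where

  ∧-trueˡ : a ∧ b ≡ true → a ≡ true
  ∧-trueˡ = ∧-conicalˡ a b

  ∧-trueʳ : a ∧ b ≡ true → b ≡ true
  ∧-trueʳ = ∧-conicalʳ a b

  ∨-falseˡ : a ∨ b ≡ false → a ≡ false
  ∨-falseˡ = ∨-conicalˡ a b

  ∨-falseʳ : a ∨ b ≡ false → b ≡ false
  ∨-falseʳ = ∨-conicalʳ a b

not-true : ∀ {a} → not a ≡ true → a ≡ false
not-true {false} _ = refl

χ : Bool → ℕ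
χ b = if b then 1 else 0

if-then-* : ∀ b c w → (if b then c * w else 0) ≡ c * (if b then w else 0)
if-then-* false c w = sym (*-zeroʳ c)
if-then-* true  c w = refl

if-χ : ∀ a g → (if a then χ g else 0) ≡ χ (a ∧ g)
if-χ false _ = refl
if-χ true  _ = refl

_==_ : ∀ {n} → Fin n → Fin n → Bool
zero  == zero  = true
zero  == suc j = false
suc i == zero  = false
suc i == suc j = i == j

==-refl : ∀ {n} (i : Fin n) → (i == i) ≡ true
==-refl zero    = refl
==-refl (suc i) = ==-refl i

==⇒≡ : ∀ {n} (i j : Fin n) → (i == j) ≡ true → i ≡ j
==⇒≡ zero    zero    _  = refl
==⇒≡ (suc i) (suc j) eq = cong suc (==⇒≡ i j eq)

==-dec : ∀ {n} (i j : Fin n) → i ≡ j ⊎ (i == j) ≡ false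
==-dec i j with i == j in i=j
... | true  = inj₁ (==⇒≡ i j i=j)
... | false = inj₂ refl

_<ᶠ_ : ∀ {n} → Fin n → Fin n → Bool
i <ᶠ j = toℕ i <ᵇ toℕ j

<ᶠ-irrefl : ∀ {n} (i : Fin n) → (i <ᶠ i) ≡ false
<ᶠ-irrefl i = go (toℕ i)
  where
  go : ∀ m → (m <ᵇ m) ≡ false
  go zero    = refl
  go (suc m) = go m

<ᶠ-connex : ∀ {n} (i j : Fin n) → i ≢ j → χ (i <ᶠ j) + χ (j <ᶠ i) ≡ 1
<ᶠ-connex i j i≢j = go (toℕ i) (toℕ j) (i≢j ∘ toℕ-injective)
  where
  go : ∀ a b → a ≢ b → χ (a <ᵇ b) + χ (b <ᵇ a) ≡ 1
  go zero    zero    a≢b = ⊥-elim (a≢b refl)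
  go zero    (suc b) _   = refl
  go (suc a) zero    _   = refl
  go (suc a) (suc b) a≢b = go a b (a≢b ∘ cong suc)

sum-zero : ∀ {n} {f : Fin n → ℕ} → (∀ i → f i ≡ 0) → sum f ≡ 0
sum-zero {zero}  f≗0 = refl
sum-zero {suc n} f≗0 = cong₂ _+_ (f≗0 zero) (sum-zero (f≗0 ∘ suc))

sum-at : ∀ {n} (v : Fin n) (h : Fin n → ℕ) → sum (λ i → if i == v then h i else 0) ≡ h v
sum-at {suc n} zero    h = trans (cong (h zero +_) (sum-zero {n} (λ _ → refl))) (+-identityʳ _)
sum-at {suc n} (suc v) h = sum-at v (h ∘ suc)

sum-if : ∀ {n} b (h : Fin n → ℕ) → sum (λ j → if b then h j else 0) ≡ (if b then sum h else 0)
sum-if {n} false h = sum-zero {n} (λ _ → refl)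
sum-if     true  h = refl

sum-threshold : ∀ a n (g : Bool → ℕ) → sum {n} (λ c → g (not (toℕ c <ᵇ a))) ≡ (a ⊓ n) * g false + (n ∸ a) * g true
sum-threshold zero    zero    g = refl
sum-threshold (suc a) zero    g = refl
sum-threshold zero    (suc n) g = cong (g true +_) (sum-threshold zero n g)
sum-threshold (suc a) (suc n) g = trans (cong (g false +_) (sum-threshold a n g)) (sym (+-assoc (g false) _ _))

Pred : ℕ → Set
Pred n = Fin n → Bool

module _ {n : ℕ} where

  infix 4 _⊆_
  infixl 7 _∩_
  infixl 6 _∪_
  infixl 6 _∖_

  _⊆_ : Pred n → Pred n → Set
  U ⊆ V = ∀ i → U i ≡ true → V i ≡ true

  _∩_ : Pred n → Pred n → Pred n
  (U ∩ V) i = U i ∧ V i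

  _∪_ : Pred n → Pred n → Pred n
  (U ∪ V) i = U i ∨ V i

  _∖_ : Pred n → Pred n → Pred n
  (U ∖ V) i = U i ∧ not (V i)

  ｛_｝ : Fin n → Pred n
  ｛ v ｝ i = i == v

  nbr : Graph n → Fin n → Pred n
  nbr G v j = G v j ∨ G j v

∖∖≡∖∪ : ∀ a x y → (a ∧ not x) ∧ not y ≡ a ∧ not (x ∨ y)
∖∖≡∖∪ a x y = trans (∧-assoc a (not x) (not y)) (cong (a ∧_) (sym (deMorgan₂ x y)))

∖-intro : ∀ {n} {P Q : Pred n} {i} → P i ≡ true → Q i ≡ false → (P ∖ Q) i ≡ true
∖-intro Pi Qi rewrite Pi | Qi = refl

remove-self : ∀ {n} (P : Pred n) v → (P ∖ ｛ v ｝) v ≡ false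
remove-self P v rewrite ==-refl v = ∧-zeroʳ (P v)

removed-≢ : ∀ {n} (P : Pred n) {v i} → (P ∖ ｛ v ｝) i ≡ true → (i == v) ≡ false
removed-≢ P {i = i} h = not-true (∧-trueʳ {a = P i} h)

card : ∀ {n} → Pred n → ℕ
card P = sum (χ ∘ P)

card-cong : ∀ {n} {P Q : Pred n} → (∀ i → P i ≡ Q i) → card P ≡ card Q
card-cong P≗Q = sum-cong-≗ (cong χ ∘ P≗Q)

card≡0⇒empty : ∀ {n} (P : Pred n) → card P ≡ 0 → ∀ i → P i ≡ false
card≡0⇒empty {suc n} P eq i with P zero in P0
card≡0⇒empty P eq zero    | false = P0
card≡0⇒empty P eq (suc i) | false = card≡0⇒empty (P ∘ suc) eq i

card≡suc⇒nonempty : ∀ {n} (P : Pred n) {c} → card P ≡ suc c → Σ (Fin n) (λ i → P i ≡ true)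
card≡suc⇒nonempty {suc n} P eq with P zero in P0
... | true  = zero , P0
... | false = let (i , Pi) = card≡suc⇒nonempty (P ∘ suc) eq in suc i , Pi

card-remove : ∀ {n} (P : Pred n) {z} → P z ≡ true → card P ≡ suc (card (P ∖ ｛ z ｝))
card-remove P {zero} Pz rewrite Pz = cong suc (card-cong (λ i → sym (∧-identityʳ (P (suc i)))))
card-remove P {suc z} Pz rewrite ∧-identityʳ (P zero) | card-remove (P ∘ suc) Pz = +-suc _ _

card-mono : ∀ {n} {P Q : Pred n} → P ⊆ Q → card P ≤ card Q
card-mono {zero}  P⊆Q = z≤n
card-mono {suc n} {P} P⊆Q with P zero in P0
... | false = +-mono-≤ z≤n (card-mono (P⊆Q ∘ suc))
... | true rewrite P⊆Q zero P0 = +-monoʳ-≤ 1 (card-mono (P⊆Q ∘ suc))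

card-strict : ∀ {n} {P Q : Pred n} → P ⊆ Q → ∀ y → P y ≡ false → Q y ≡ true → card P < card Q
card-strict {P = P} P⊆Q zero Py Qy rewrite Py | Qy = s≤s (card-mono (P⊆Q ∘ suc))
card-strict {P = P} P⊆Q (suc y) Py Qy with P zero in P0
... | false = ≤-trans (card-strict (P⊆Q ∘ suc) y Py Qy) (m≤n+m _ _)
... | true rewrite P⊆Q zero P0 = s≤s (card-strict (P⊆Q ∘ suc) y Py Qy)

card-split : ∀ {n} (P Q : Pred n) → card P ≡ card (P ∩ Q) + card (P ∖ Q)
card-split P Q = trans (sum-cong-≗ χ-split) (∑-distrib-+ (χ ∘ (P ∩ Q)) (χ ∘ (P ∖ Q)))
  where
  χ-split : ∀ i → χ (P i) ≡ χ (P i ∧ Q i) + χ (P i ∧ not (Q i))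
  χ-split i with P i | Q i
  ... | false | _     = refl
  ... | true  | false = refl
  ... | true  | true  = refl

full : ∀ {n} → Pred n
full _ = true

card-full : ∀ n → card (full {n}) ≡ n
card-full zero    = refl
card-full (suc n) = cong suc (card-full n)

-- Independent sets

lookup-≔true : ∀ {n} (τ : Vec Bool n) v {i} → lookup τ i ≡ true → lookup (τ [ v ]≔ true) i ≡ true
lookup-≔true (x ∷ τ) zero    {zero}  τi = refl
lookup-≔true (x ∷ τ) zero    {suc i} τi = τi
lookup-≔true (x ∷ τ) (suc v) {zero}  τi = τi
lookup-≔true (x ∷ τ) (suc v) {suc i} τi = lookup-≔true τ v τi

lookup-≔true⁻ : ∀ {n} (τ : Vec Bool n) v {i} → lookup (τ [ v ]≔ true) i ≡ true → i ≡ v ⊎ lookup τ i ≡ true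
lookup-≔true⁻ (x ∷ τ) zero    {zero}  _   = inj₁ refl
lookup-≔true⁻ (x ∷ τ) zero    {suc i} τ'i = inj₂ τ'i
lookup-≔true⁻ (x ∷ τ) (suc v) {zero}  τ'i = inj₂ τ'i
lookup-≔true⁻ (x ∷ τ) (suc v) {suc i} τ'i = map₁ (cong suc) (lookup-≔true⁻ τ v τ'i)

∑ᴮ : (n : ℕ) → (Vec Bool n → ℕ) → ℕ
∑ᴮ zero    g = g []
∑ᴮ (suc n) g = ∑ᴮ n (g ∘ (false ∷_)) + ∑ᴮ n (g ∘ (true ∷_))

∑ᴮ-cong : ∀ n {g h : Vec Bool n → ℕ} → (∀ τ → g τ ≡ h τ) → ∑ᴮ n g ≡ ∑ᴮ n h
∑ᴮ-cong zero    g≗h = g≗h []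
∑ᴮ-cong (suc n) g≗h = cong₂ _+_ (∑ᴮ-cong n (g≗h ∘ (false ∷_))) (∑ᴮ-cong n (g≗h ∘ (true ∷_)))

∑ᴮ-mono-≤ : ∀ n {g h : Vec Bool n → ℕ} → (∀ τ → g τ ≤ h τ) → ∑ᴮ n g ≤ ∑ᴮ n h
∑ᴮ-mono-≤ zero    g≤h = g≤h []
∑ᴮ-mono-≤ (suc n) g≤h = +-mono-≤ (∑ᴮ-mono-≤ n (g≤h ∘ (false ∷_))) (∑ᴮ-mono-≤ n (g≤h ∘ (true ∷_)))

∑ᴮ-distrib-+ : ∀ n (g h : Vec Bool n → ℕ) → ∑ᴮ n (λ τ → g τ + h τ) ≡ ∑ᴮ n g + ∑ᴮ n h
∑ᴮ-distrib-+ zero    g h = refl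
∑ᴮ-distrib-+ (suc n) g h = trans
  (cong₂ _+_ (∑ᴮ-distrib-+ n (g ∘ (false ∷_)) (h ∘ (false ∷_))) (∑ᴮ-distrib-+ n (g ∘ (true ∷_)) (h ∘ (true ∷_))))
  (+-interchange (∑ᴮ n (g ∘ (false ∷_))) (∑ᴮ n (h ∘ (false ∷_))) (∑ᴮ n (g ∘ (true ∷_))) (∑ᴮ n (h ∘ (true ∷_))))

*-distribˡ-∑ᴮ : ∀ n c (g : Vec Bool n → ℕ) → ∑ᴮ n (λ τ → c * g τ) ≡ c * ∑ᴮ n g
*-distribˡ-∑ᴮ zero    c g = refl
*-distribˡ-∑ᴮ (suc n) c g = trans
  (cong₂ _+_ (*-distribˡ-∑ᴮ n c (g ∘ (false ∷_))) (*-distribˡ-∑ᴮ n c (g ∘ (true ∷_))))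
  (sym (*-distribˡ-+ c _ _))

∑ᴮ-zero : ∀ n → ∑ᴮ n (λ _ → 0) ≡ 0
∑ᴮ-zero zero    = refl
∑ᴮ-zero (suc n) = cong₂ _+_ (∑ᴮ-zero n) (∑ᴮ-zero n)

∑ᴮ-split : ∀ n (v : Fin n) (g : Vec Bool n → ℕ) →
  ∑ᴮ n g ≡ ∑ᴮ n (λ τ → if lookup τ v then 0 else g τ)
         + ∑ᴮ n (λ τ → if lookup τ v then 0 else g (τ [ v ]≔ true))
∑ᴮ-split (suc n) zero    g rewrite ∑ᴮ-zero n =
  sym (cong₂ _+_ (+-identityʳ (∑ᴮ n (g ∘ (false ∷_)))) (+-identityʳ (∑ᴮ n (g ∘ (true ∷_)))))
∑ᴮ-split (suc n) (suc v) g = trans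
  (cong₂ _+_ (∑ᴮ-split n v (g ∘ (false ∷_))) (∑ᴮ-split n v (g ∘ (true ∷_))))
  (+-interchange (∑ᴮ n (λ σ → if lookup σ v then 0 else g (false ∷ σ)))
               (∑ᴮ n (λ σ → if lookup σ v then 0 else g (false ∷ σ [ v ]≔ true)))
               (∑ᴮ n (λ σ → if lookup σ v then 0 else g (true ∷ σ)))
               (∑ᴮ n (λ σ → if lookup σ v then 0 else g (true ∷ σ [ v ]≔ true))))

tailᴳ : ∀ {n} → Graph (suc n) → Graph n
tailᴳ G i j = G (suc i) (suc j)

infix 4 _⊆ᵇ_

_⊆ᵇ_ : ∀ {n} → Vec Bool n → Pred n → Bool
[]      ⊆ᵇ U = true
(x ∷ τ) ⊆ᵇ U = (not x ∨ U zero) ∧ (τ ⊆ᵇ U ∘ suc)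

independent : ∀ {n} → Graph n → Vec Bool n → Bool
independent G []      = true
independent G (x ∷ τ) =
  (not x ∨ (not (G zero zero) ∧ (τ ⊆ᵇ λ j → not (nbr G zero (suc j))))) ∧ independent (tailᴳ G) τ

Independent : ∀ {n} → Graph n → Vec Bool n → Set
Independent G τ = ∀ i j → lookup τ i ≡ true → lookup τ j ≡ true → G i j ≡ false

⊆ᵇ-sound : ∀ {n} (τ : Vec Bool n) U → (τ ⊆ᵇ U) ≡ true → ∀ i → lookup τ i ≡ true → U i ≡ true
⊆ᵇ-sound (true ∷ τ) U τ⊆U zero    _  = ∧-trueˡ τ⊆U
⊆ᵇ-sound (x    ∷ τ) U τ⊆U (suc i) τi = ⊆ᵇ-sound τ (U ∘ suc) (∧-trueʳ τ⊆U) i τi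

⊆ᵇ-complete : ∀ {n} (τ : Vec Bool n) U → (∀ i → lookup τ i ≡ true → U i ≡ true) → (τ ⊆ᵇ U) ≡ true
⊆ᵇ-complete []           U τ⊆U = refl
⊆ᵇ-complete (false ∷ τ) U τ⊆U = ⊆ᵇ-complete τ (U ∘ suc) (τ⊆U ∘ suc)
⊆ᵇ-complete (true  ∷ τ) U τ⊆U = cong₂ _∧_ (τ⊆U zero refl) (⊆ᵇ-complete τ (U ∘ suc) (τ⊆U ∘ suc))

⊆ᵇ-mono : ∀ {n} {U V : Pred n} → U ⊆ V → ∀ τ → (τ ⊆ᵇ U) ≡ true → (τ ⊆ᵇ V) ≡ true
⊆ᵇ-mono U⊆V τ τ⊆U = ⊆ᵇ-complete τ _ (λ i τi → U⊆V i (⊆ᵇ-sound τ _ τ⊆U i τi))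

⊆ᵇ-cong : ∀ {n} {U V : Pred n} → (∀ i → U i ≡ V i) → ∀ τ → (τ ⊆ᵇ U) ≡ (τ ⊆ᵇ V)
⊆ᵇ-cong U≗V []      = refl
⊆ᵇ-cong U≗V (x ∷ τ) = cong₂ (λ u s → (not x ∨ u) ∧ s) (U≗V zero) (⊆ᵇ-cong (U≗V ∘ suc) τ)

⊆ᵇ-∩ : ∀ {n} (U V : Pred n) τ → (τ ⊆ᵇ U ∩ V) ≡ (τ ⊆ᵇ U) ∧ (τ ⊆ᵇ V)
⊆ᵇ-∩ U V []           = refl
⊆ᵇ-∩ U V (false ∷ τ) = ⊆ᵇ-∩ (U ∘ suc) (V ∘ suc) τ
⊆ᵇ-∩ U V (true  ∷ τ) with U zero | V zero
... | false | _     = refl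
... | true  | false = sym (∧-zeroʳ _)
... | true  | true  = ⊆ᵇ-∩ (U ∘ suc) (V ∘ suc) τ

⊆ᵇ-outside : ∀ {n} (U : Pred n) {v} τ → lookup τ v ≡ true → U v ≡ false → (τ ⊆ᵇ U) ≡ false
⊆ᵇ-outside U {zero}  (true ∷ τ) τv Uv rewrite Uv = refl
⊆ᵇ-outside U {suc v} (x    ∷ τ) τv Uv rewrite ⊆ᵇ-outside (U ∘ suc) τ τv Uv = ∧-zeroʳ _

⊆ᵇ-remove : ∀ {n} (U : Pred n) {v} τ → lookup τ v ≡ false → (τ ⊆ᵇ U) ≡ (τ ⊆ᵇ U ∖ ｛ v ｝)
⊆ᵇ-remove U {zero}  (false ∷ τ) τv = ⊆ᵇ-cong (λ i → sym (∧-identityʳ (U (suc i)))) τ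
⊆ᵇ-remove U {suc v} (x     ∷ τ) τv rewrite ∧-identityʳ (U zero) =
  cong ((not x ∨ U zero) ∧_) (⊆ᵇ-remove (U ∘ suc) τ τv)

⊆ᵇ-insert : ∀ {n} (U : Pred n) v τ → (τ [ v ]≔ true ⊆ᵇ U) ≡ U v ∧ (τ ⊆ᵇ U)
⊆ᵇ-insert U v τ = ⇔→≡ {z = true} (mk⇔
  (λ τ'⊆U → cong₂ _∧_ (⊆ᵇ-sound τ' U τ'⊆U v (lookup∘update v τ true))
                      (⊆ᵇ-complete τ U (λ i τi → ⊆ᵇ-sound τ' U τ'⊆U i (lookup-≔true τ v τi))))
  (λ Uv∧τ⊆U → ⊆ᵇ-complete τ' U (λ i τ'i → [ (λ { refl → ∧-trueˡ Uv∧τ⊆U })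
                                          , ⊆ᵇ-sound τ U (∧-trueʳ Uv∧τ⊆U) i ]′ (lookup-≔true⁻ τ v τ'i))))
  where τ' = τ [ v ]≔ true

independent-∷⁻ : ∀ {n} (G : Graph (suc n)) τ → independent G (true ∷ τ) ≡ true →
  G zero zero ≡ false × (∀ j → lookup τ j ≡ true → nbr G zero (suc j) ≡ false)
independent-∷⁻ G τ ind = not-true (∧-trueˡ headOK) , λ j τj → not-true (⊆ᵇ-sound τ _ (∧-trueʳ headOK) j τj)
  where
  headOK : not (G zero zero) ∧ (τ ⊆ᵇ λ j → not (nbr G zero (suc j))) ≡ true
  headOK = ∧-trueˡ ind

independent-sound : ∀ {n} (G : Graph n) τ → independent G τ ≡ true → Independent G τ
independent-sound G (true ∷ τ) ind zero    zero    _  _  = proj₁ (independent-∷⁻ G τ ind)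
independent-sound G (true ∷ τ) ind zero    (suc j) _  τj = ∨-falseˡ (proj₂ (independent-∷⁻ G τ ind) j τj)
independent-sound G (true ∷ τ) ind (suc i) zero    τi _  = ∨-falseʳ (proj₂ (independent-∷⁻ G τ ind) i τi)
independent-sound G (x    ∷ τ) ind (suc i) (suc j) τi τj =
  independent-sound (tailᴳ G) τ (∧-trueʳ ind) i j τi τj

independent-complete : ∀ {n} (G : Graph n) τ → Independent G τ → independent G τ ≡ true
independent-complete G []           ind = refl
independent-complete G (false ∷ τ) ind = independent-complete (tailᴳ G) τ (λ i j → ind (suc i) (suc j))
independent-complete G (true  ∷ τ) ind rewrite ind zero zero refl refl = cong₂ _∧_
  (⊆ᵇ-complete τ (λ j → not (nbr G zero (suc j))) (λ j τj → cong not (cong₂ _∨_ (ind zero (suc j) refl τj) (ind (suc j) zero τj refl))))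
  (independent-complete (tailᴳ G) τ (λ i j → ind (suc i) (suc j)))

independent-within : ∀ {n} (U : Pred n) (G : Graph n) → (∀ i j → U i ≡ true → U j ≡ true → G i j ≡ false) →
  ∀ τ → (τ ⊆ᵇ U) ≡ true → independent G τ ≡ true
independent-within U G U-indep τ τ⊆U = independent-complete G τ
  (λ i j τi τj → U-indep i j (⊆ᵇ-sound τ U τ⊆U i τi) (⊆ᵇ-sound τ U τ⊆U j τj))

independent-congOn : ∀ {n} (U : Pred n) (G G' : Graph n) → (∀ i j → U i ≡ true → U j ≡ true → G i j ≡ G' i j) →
  ∀ τ → (τ ⊆ᵇ U) ≡ true → independent G τ ≡ independent G' τ
independent-congOn U G G' G≗G' τ τ⊆U = ⇔→≡ {z = true} (mk⇔
  (transfer G G' G≗G')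
  (transfer G' G (λ i j Ui Uj → sym (G≗G' i j Ui Uj))))
  where
  transfer : ∀ H H' → (∀ i j → U i ≡ true → U j ≡ true → H i j ≡ H' i j) →
    independent H τ ≡ true → independent H' τ ≡ true
  transfer H H' H≗H' indH = independent-complete H' τ (λ i j τi τj →
    trans (sym (H≗H' i j (⊆ᵇ-sound τ U τ⊆U i τi) (⊆ᵇ-sound τ U τ⊆U j τj))) (independent-sound H τ indH i j τi τj))

independent-insert : ∀ {n} (G : Graph n) v τ →
  independent G (τ [ v ]≔ true) ≡ (not (G v v) ∧ (τ ⊆ᵇ λ j → not (nbr G v j))) ∧ independent G τ
independent-insert {n} G v τ = ⇔→≡ {z = true} (mk⇔ split join)
  where
  τ' : Vec Bool n
  τ' = τ [ v ]≔ true
  split : independent G τ' ≡ true → (not (G v v) ∧ (τ ⊆ᵇ λ j → not (nbr G v j))) ∧ independent G τ ≡ true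
  split ind' = cong₂ _∧_
    (cong₂ _∧_ (cong not (I' v v τ'v τ'v))
               (⊆ᵇ-complete τ (λ j → not (nbr G v j)) (λ j τj → cong not (cong₂ _∨_ (I' v j τ'v (lookup-≔true τ v τj))
                                                            (I' j v (lookup-≔true τ v τj) τ'v)))))
    (independent-complete G τ (λ i j τi τj → I' i j (lookup-≔true τ v τi) (lookup-≔true τ v τj)))
    where
    I' : Independent G τ'
    I' = independent-sound G τ' ind'
    τ'v : lookup τ' v ≡ true
    τ'v = lookup∘update v τ true
  join : (not (G v v) ∧ (τ ⊆ᵇ λ j → not (nbr G v j))) ∧ independent G τ ≡ true → independent G τ' ≡ true
  join hyp = independent-complete G τ' I'
    where
    headOK : not (G v v) ∧ (τ ⊆ᵇ λ j → not (nbr G v j)) ≡ true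
    headOK = ∧-trueˡ hyp
    Gvv : G v v ≡ false
    Gvv = not-true (∧-trueˡ headOK)
    τ⊆∁N : ∀ j → lookup τ j ≡ true → not (nbr G v j) ≡ true
    τ⊆∁N = ⊆ᵇ-sound τ (λ j → not (nbr G v j)) (∧-trueʳ headOK)
    I : Independent G τ
    I = independent-sound G τ (∧-trueʳ hyp)
    I' : Independent G τ'
    I' i j τ'i τ'j with lookup-≔true⁻ τ v τ'i | lookup-≔true⁻ τ v τ'j
    ... | inj₁ refl | inj₁ refl = Gvv
    ... | inj₁ refl | inj₂ τj   = ∨-falseˡ (not-true (τ⊆∁N j τj))
    ... | inj₂ τi   | inj₁ refl = ∨-falseʳ (not-true (τ⊆∁N i τi))
    ... | inj₂ τi   | inj₂ τj   = I i j τi τj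

edge : ∀ {n} → Pred n → Graph n → Fin n → Fin n → Bool
edge A G i j = (i <ᶠ j) ∧ (A i ∧ (A j ∧ G i j))

edgesIn : ∀ {n} → Pred n → Graph n → ℕ
edgesIn A G = sum λ i → sum λ j → χ (edge A G i j)

degIn : ∀ {n} → Pred n → Graph n → Fin n → ℕ
degIn A G v = card (A ∩ G v)

edgesIn-congᴳ : ∀ {n} (A : Pred n) (G G' : Graph n) → (∀ i j → A i ≡ true → A j ≡ true → G i j ≡ G' i j) →
  edgesIn A G ≡ edgesIn A G'
edgesIn-congᴳ A G G' G≗G' = sum-cong-≗ λ i → sum-cong-≗ λ j → cong χ (same i j)
  where
  same : ∀ i j → edge A G i j ≡ edge A G' i j
  same i j with A i in Ai | A j in Aj
  ... | false | _     = refl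
  ... | true  | false = refl
  ... | true  | true  rewrite G≗G' i j Ai Aj = refl

edgesIn-remove : ∀ {n} (A : Pred n) (G : Graph n) {v} → A v ≡ true → IsSimple G →
  edgesIn A G ≡ edgesIn (A ∖ ｛ v ｝) G + degIn A G v
edgesIn-remove {n} A G {v} Av simple = begin
  edgesIn A G
    ≡⟨ sum-cong-≗ (λ i → sum-cong-≗ (λ j → by-endpoints i j)) ⟩
  sum (λ i → sum (λ j → χ (edge A' G i j) + (at-v i j + at-v' i j)))
    ≡⟨ sum-cong-≗ (λ i → trans (∑-distrib-+ (χ ∘ edge A' G i) (λ j → at-v i j + at-v' i j))
                                (cong (sum (χ ∘ edge A' G i) +_) (∑-distrib-+ (at-v i) (at-v' i)))) ⟩
  sum (λ i → sum (χ ∘ edge A' G i) + (sum (at-v i) + sum (at-v' i)))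
    ≡⟨ trans (∑-distrib-+ (λ i → sum (χ ∘ edge A' G i)) (λ i → sum (at-v i) + sum (at-v' i)))
             (cong (edgesIn A' G +_) (∑-distrib-+ (λ i → sum (at-v i)) (λ i → sum (at-v' i)))) ⟩
  edgesIn A' G + (sum (λ i → sum (at-v i)) + sum (λ i → sum (at-v' i)))
    ≡⟨ cong (edgesIn A' G +_) (cong₂ _+_
         (trans (sum-cong-≗ (λ i → sum-if (i == v) (from-v i))) (sum-at v (λ i → sum (from-v i))))
         (sum-cong-≗ (λ i → sum-at v (to-v i)))) ⟩
  edgesIn A' G + (sum (from-v v) + sum (λ j → to-v j v))
    ≡⟨ cong (edgesIn A' G +_) (trans (sym (∑-distrib-+ (from-v v) (λ j → to-v j v))) (sum-cong-≗ either-direction)) ⟩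
  edgesIn A' G + degIn A G v ∎
  where
  open ≡-Reasoning
  open IsSimple simple renaming (sym to G-sym; irrefl to G-irrefl)
  A' : Pred n
  A' = A ∖ ｛ v ｝
  from-v to-v : Fin n → Fin n → ℕ
  from-v i j = χ ((i <ᶠ j) ∧ (A j ∧ G i j))
  to-v   i j = χ ((i <ᶠ j) ∧ (A i ∧ G i j))
  at-v at-v' : Fin n → Fin n → ℕ
  at-v  i j = if i == v then from-v i j else 0
  at-v' i j = if j == v then to-v i j else 0
  by-endpoints : ∀ i j → χ (edge A G i j) ≡ χ (edge A' G i j) + (at-v i j + at-v' i j)
  by-endpoints i j with i == v in i=v | j == v in j=v
  ... | true  | true  rewrite ==⇒≡ i v i=v | ==⇒≡ j v j=v | <ᶠ-irrefl v = refl
  ... | true  | false rewrite ==⇒≡ i v i=v | Av with v <ᶠ j | A j ∧ G v j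
  ...   | false | _     = refl
  ...   | true  | false = refl
  ...   | true  | true  = refl
  by-endpoints i j | false | true rewrite ==⇒≡ j v j=v | Av with i <ᶠ v | A i | G i v
  ...   | false | _     | _     = refl
  ...   | true  | false | _     = refl
  ...   | true  | true  | false = refl
  ...   | true  | true  | true  = refl
  by-endpoints i j | false | false
    rewrite ∧-identityʳ (A i) | ∧-identityʳ (A j) = sym (+-identityʳ _)
  either-direction : ∀ j → from-v v j + to-v j v ≡ χ (A j ∧ G v j)
  either-direction j with j == v in j=v
  ... | true rewrite ==⇒≡ j v j=v | G-irrefl v | <ᶠ-irrefl v | ∧-zeroʳ (A v) = refl
  ... | false rewrite G-sym j v with v <ᶠ j | j <ᶠ v | <ᶠ-connex v j (λ { refl → not-¬ (==-refl v) j=v })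
  ...   | false | true  | _ = refl
  ...   | true  | false | _ = +-identityʳ _

nbrs⊆others : ∀ {n} (A : Pred n) (G : Graph n) v → G v v ≡ false → A ∩ G v ⊆ A ∖ ｛ v ｝
nbrs⊆others A G v Gvv j Aj∧Gvj with j == v in j=v
... | false = trans (∧-identityʳ (A j)) (∧-trueˡ Aj∧Gvj)
... | true rewrite ==⇒≡ j v j=v = ⊥-elim (not-¬ Gvv (∧-trueʳ Aj∧Gvj))

pairs : ℕ → ℕ
pairs zero    = 0
pairs (suc k) = k + pairs k

pairs-mono : ∀ j d → pairs d ≤ pairs (j + d)
pairs-mono zero    d = ≤-refl
pairs-mono (suc j) d = ≤-trans (pairs-mono j d) (m≤n+m (pairs (j + d)) (j + d))

edgesIn-≤ : ∀ {n} (A : Pred n) (G : Graph n) → IsSimple G → edgesIn A G ≤ pairs (card A)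
edgesIn-≤ A G simple = go (card A) A refl
  where
  go : ∀ c A → card A ≡ c → edgesIn A G ≤ pairs c
  go zero A empty = ≤-reflexive (sum-zero λ i → sum-zero λ j → cong χ (no-edge i j))
    where
    no-edge : ∀ i j → edge A G i j ≡ false
    no-edge i j rewrite card≡0⇒empty A empty i = ∧-zeroʳ (i <ᶠ j)
  go (suc c) A count with card≡suc⇒nonempty A count
  ... | v , Av = begin
    edgesIn A G                                  ≡⟨ edgesIn-remove A G Av simple ⟩
    edgesIn (A ∖ ｛ v ｝) G + degIn A G v          ≤⟨ +-mono-≤ (go c (A ∖ ｛ v ｝) count') deg≤c ⟩
    pairs c + c                                  ≡⟨ +-comm (pairs c) c ⟩
    pairs (suc c)                                ∎
    where
    open ≤-Reasoning
    count' : card (A ∖ ｛ v ｝) ≡ c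
    count' = suc-injective (trans (sym (card-remove A Av)) count)
    deg≤c : degIn A G v ≤ c
    deg≤c = subst (degIn A G v ≤_) count' (card-mono (nbrs⊆others A G v (IsSimple.irrefl simple v)))

module _ {A : Set} where

  length-filterᵇ : ∀ (P : A → Bool) xs → length (filterᵇ P xs) ≡ sumᴸ (map (χ ∘ P) xs)
  length-filterᵇ P []       = refl
  length-filterᵇ P (x ∷ xs) with P x
  ... | true  = cong suc (length-filterᵇ P xs)
  ... | false = length-filterᵇ P xs

  sumᴸ-filterᵇ : ∀ (P : A → Bool) (g : A → ℕ) xs →
    sumᴸ (map g (filterᵇ P xs)) ≡ sumᴸ (map (λ x → if P x then g x else 0) xs)
  sumᴸ-filterᵇ P g []       = refl
  sumᴸ-filterᵇ P g (x ∷ xs) with P x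
  ... | true  = cong (g x +_) (sumᴸ-filterᵇ P g xs)
  ... | false = sumᴸ-filterᵇ P g xs

  sumᴸ-cong : ∀ {g h : A → ℕ} → (∀ x → g x ≡ h x) → ∀ xs → sumᴸ (map g xs) ≡ sumᴸ (map h xs)
  sumᴸ-cong g≗h xs = cong sumᴸ (map-cong g≗h xs)

  sumᴸ-distrib-+ : ∀ (g h : A → ℕ) xs → sumᴸ (map (λ x → g x + h x) xs) ≡ sumᴸ (map g xs) + sumᴸ (map h xs)
  sumᴸ-distrib-+ g h []       = refl
  sumᴸ-distrib-+ g h (x ∷ xs) =
    trans (cong (g x + h x +_) (sumᴸ-distrib-+ g h xs)) (+-interchange (g x) (h x) (sumᴸ (map g xs)) (sumᴸ (map h xs)))

  *-distribˡ-sumᴸ : ∀ c (g : A → ℕ) xs → sumᴸ (map (λ x → c * g x) xs) ≡ c * sumᴸ (map g xs)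
  *-distribˡ-sumᴸ c g []       = sym (*-zeroʳ c)
  *-distribˡ-sumᴸ c g (x ∷ xs) = trans (cong (c * g x +_) (*-distribˡ-sumᴸ c g xs)) (sym (*-distribˡ-+ c (g x) _))

  sumᴸ-concatMap : ∀ {B : Set} (g : B → ℕ) (f : A → List B) xs →
    sumᴸ (map g (concatMap f xs)) ≡ sumᴸ (map (λ x → sumᴸ (map g (f x))) xs)
  sumᴸ-concatMap g f []       = refl
  sumᴸ-concatMap g f (x ∷ xs) = begin
    sumᴸ (map g (f x ++ concatMap f xs))               ≡⟨ cong sumᴸ (map-++ g (f x) (concatMap f xs)) ⟩
    sumᴸ (map g (f x) ++ map g (concatMap f xs))       ≡⟨ sumᴸ-++ (map g (f x)) _ ⟩
    sumᴸ (map g (f x)) + sumᴸ (map g (concatMap f xs)) ≡⟨ cong (sumᴸ (map g (f x)) +_) (sumᴸ-concatMap g f xs) ⟩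
    sumᴸ (map g (f x)) + sumᴸ (map (λ x → sumᴸ (map g (f x))) xs) ∎
    where open ≡-Reasoning

  sumᴸ-map : ∀ {B : Set} (g : B → ℕ) (f : A → B) xs → sumᴸ (map g (map f xs)) ≡ sumᴸ (map (g ∘ f) xs)
  sumᴸ-map g f xs = cong sumᴸ (sym (map-∘ xs))

sumᴸ-allFin : ∀ n (g : Fin n → ℕ) → sumᴸ (map g (allFin n)) ≡ sum g
sumᴸ-allFin n g = trans (cong sumᴸ (map-tabulate (λ i → i) g)) (sumᴸ-tabulate n g)
  where
  sumᴸ-tabulate : ∀ n (g : Fin n → ℕ) → sumᴸ (tabulate g) ≡ sum g
  sumᴸ-tabulate zero    g = refl
  sumᴸ-tabulate (suc n) g = cong (g zero +_) (sumᴸ-tabulate n (g ∘ suc))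

and-++ : ∀ xs ys → and (xs ++ ys) ≡ and xs ∧ and ys
and-++ []       ys = refl
and-++ (x ∷ xs) ys = trans (cong (x ∧_) (and-++ xs ys)) (sym (∧-assoc x (and xs) (and ys)))

and-concatMap : ∀ {A : Set} (f : A → List Bool) xs → and (concatMap f xs) ≡ and (map (and ∘ f) xs)
and-concatMap f []       = refl
and-concatMap f (x ∷ xs) = trans (and-++ (f x) (concatMap f xs)) (cong (and (f x) ∧_) (and-concatMap f xs))

and-allFin : ∀ {n} (g : Fin n → Bool) → and (map g (allFin n)) ≡ true ⇔ (∀ i → g i ≡ true)
and-allFin {n} g rewrite map-tabulate (λ i → i) g = mk⇔ (to n g) (from n g)
  where
  to : ∀ n (g : Fin n → Bool) → and (tabulate g) ≡ true → ∀ i → g i ≡ true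
  to (suc n) g all zero    = ∧-trueˡ all
  to (suc n) g all (suc i) = to n (g ∘ suc) (∧-trueʳ {a = g zero} all) i
  from : ∀ n (g : Fin n → Bool) → (∀ i → g i ≡ true) → and (tabulate g) ≡ true
  from zero    g _   = refl
  from (suc n) g all = cong₂ _∧_ (all zero) (from n (g ∘ suc) (all ∘ suc))

isHom⇔ : ∀ {n k} (G : Graph n) (H : Graph k) (φ : Fin n → Fin k) →
  isHom G H φ ≡ true ⇔ (∀ i j → not (G i j) ∨ H (φ i) (φ j) ≡ true)
isHom⇔ {n} G H φ = mk⇔
  (λ ok i j → Equivalence.to (and-allFin (edge-ok i)) (Equivalence.to (and-allFin rows) (trans (sym split) ok) i) j)
  (λ ok → trans split (Equivalence.from (and-allFin rows) (λ i → Equivalence.from (and-allFin (edge-ok i)) (ok i))))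
  where
  edge-ok : Fin n → Fin n → Bool
  edge-ok i j = not (G i j) ∨ H (φ i) (φ j)
  rows : Fin n → Bool
  rows i = and (map (edge-ok i) (allFin n))
  split : isHom G H φ ≡ and (map rows (allFin n))
  split = and-concatMap (λ i → map (edge-ok i) (allFin n)) (allFin n)

edgeCount≡edgesIn : ∀ {n} (G : Graph n) → edgeCount G ≡ edgesIn full G
edgeCount≡edgesIn {n} G = begin
  edgeCount G
    ≡⟨ length-filterᵇ adjacent (concatMap later-pairs (allFin n)) ⟩
  sumᴸ (map (χ ∘ adjacent) (concatMap later-pairs (allFin n)))
    ≡⟨ sumᴸ-concatMap (χ ∘ adjacent) later-pairs (allFin n) ⟩
  sumᴸ (map (λ i → sumᴸ (map (χ ∘ adjacent) (later-pairs i))) (allFin n))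
    ≡⟨ sumᴸ-allFin n _ ⟩
  sum (λ i → sumᴸ (map (χ ∘ adjacent) (later-pairs i)))
    ≡⟨ sum-cong-≗ row ⟩
  edgesIn full G ∎
  where
  open ≡-Reasoning
  adjacent : Fin n × Fin n → Bool
  adjacent (i , j) = G i j
  later-pairs : Fin n → List (Fin n × Fin n)
  later-pairs i = map (i ,_) (filterᵇ (i <ᶠ_) (allFin n))
  row : ∀ i → sumᴸ (map (χ ∘ adjacent) (later-pairs i)) ≡ sum (λ j → χ (edge full G i j))
  row i = begin
    sumᴸ (map (χ ∘ adjacent) (later-pairs i))
      ≡⟨ sumᴸ-map (χ ∘ adjacent) (i ,_) (filterᵇ (i <ᶠ_) (allFin n)) ⟩
    sumᴸ (map (χ ∘ G i) (filterᵇ (i <ᶠ_) (allFin n)))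
      ≡⟨ sumᴸ-filterᵇ (i <ᶠ_) (χ ∘ G i) (allFin n) ⟩
    sumᴸ (map (λ j → if i <ᶠ j then χ (G i j) else 0) (allFin n))
      ≡⟨ sumᴸ-allFin n _ ⟩
    sum (λ j → if i <ᶠ j then χ (G i j) else 0)
      ≡⟨ sum-cong-≗ (λ j → χ-∧ (i <ᶠ j) (G i j)) ⟩
    sum (λ j → χ (edge full G i j)) ∎
    where
    χ-∧ : ∀ a g → (if a then χ g else 0) ≡ χ (a ∧ g)
    χ-∧ false _ = refl
    χ-∧ true  _ = refl

countSubsets : ∀ n → (Subset n → Bool) → ℕ
countSubsets n P = length (filterᵇ P (allSubsets n))

countSubsets-cong : ∀ n {P Q : Subset n → Bool} → (∀ s → P s ≡ Q s) → countSubsets n P ≡ countSubsets n Q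
countSubsets-cong n {P} {Q} P≗Q = trans (length-filterᵇ P (allSubsets n))
  (trans (sumᴸ-cong (cong χ ∘ P≗Q) (allSubsets n)) (sym (length-filterᵇ Q (allSubsets n))))

countSubsets-suc : ∀ n (P : Subset (suc n) → Bool) →
  countSubsets (suc n) P ≡ countSubsets n (P ∘ (true ∷_)) + countSubsets n (P ∘ (false ∷_))
countSubsets-suc n P = begin
  countSubsets (suc n) P
    ≡⟨ length-filterᵇ P (allSubsets (suc n)) ⟩
  sumᴸ (map (χ ∘ P) (allSubsets (suc n)))
    ≡⟨ sumᴸ-concatMap (χ ∘ P) (λ s → (true ∷ s) ∷ (false ∷ s) ∷ []) (allSubsets n) ⟩
  sumᴸ (map (λ s → χ (P (true ∷ s)) + (χ (P (false ∷ s)) + 0)) (allSubsets n))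
    ≡⟨ sumᴸ-cong (λ s → cong (χ (P (true ∷ s)) +_) (+-identityʳ _)) (allSubsets n) ⟩
  sumᴸ (map (λ s → χ (P (true ∷ s)) + χ (P (false ∷ s))) (allSubsets n))
    ≡⟨ sumᴸ-distrib-+ (χ ∘ P ∘ (true ∷_)) (χ ∘ P ∘ (false ∷_)) (allSubsets n) ⟩
  sumᴸ (map (χ ∘ P ∘ (true ∷_)) (allSubsets n)) + sumᴸ (map (χ ∘ P ∘ (false ∷_)) (allSubsets n))
    ≡⟨ cong₂ _+_ (length-filterᵇ (P ∘ (true ∷_)) (allSubsets n)) (length-filterᵇ (P ∘ (false ∷_)) (allSubsets n)) ⟨
  countSubsets n (P ∘ (true ∷_)) + countSubsets n (P ∘ (false ∷_)) ∎
  where open ≡-Reasoning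

countSubsets-none : ∀ n (P : Subset n → Bool) → (∀ s → P s ≡ false) → countSubsets n P ≡ 0
countSubsets-none n P none = trans (countSubsets-cong n none) (nothing (allSubsets n))
  where
  nothing : ∀ ss → length (filterᵇ (λ (_ : Subset n) → false) ss) ≡ 0
  nothing []       = refl
  nothing (_ ∷ ss) = nothing ss

count-empty : ∀ n → countSubsets n (λ s → ∣ s ∣ ≡ᵇ 0) ≡ 1
count-empty zero    = refl
count-empty (suc n) = trans (countSubsets-suc n _)
  (trans (cong (_+ countSubsets n (λ s → ∣ s ∣ ≡ᵇ 0)) (countSubsets-none n _ (λ _ → refl))) (count-empty n))

count-singletons : ∀ n → countSubsets n (λ s → ∣ s ∣ ≡ᵇ 1) ≡ n
count-singletons zero    = refl
count-singletons (suc n) = trans (countSubsets-suc n _) (cong₂ _+_ (count-empty n) (count-singletons n))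

isPair : ∀ {n} → Subset n → Bool
isPair s = ⌊ ∣ s ∣ ℕ.≟ 2 ⌋

isPair-∷ : ∀ {n} (s : Subset n) → isPair (true ∷ s) ≡ (∣ s ∣ ≡ᵇ 1)
isPair-∷ s with ∣ s ∣
... | zero          = refl
... | suc zero      = refl
... | suc (suc _)   = refl

lexRank≡count : ∀ n (s : Subset n) → lexRank s ≡ countSubsets n (λ t → isPair t ∧ lex< t s)
lexRank≡count n s = begin
  lexRank s
    ≡⟨ length-filterᵇ (λ t → lex< t s) (twoSubsets n) ⟩
  sumᴸ (map (λ t → χ (lex< t s)) (filterᵇ isPair (allSubsets n)))
    ≡⟨ sumᴸ-filterᵇ isPair (λ t → χ (lex< t s)) (allSubsets n) ⟩
  sumᴸ (map (λ t → if isPair t then χ (lex< t s) else 0) (allSubsets n))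
    ≡⟨ sumᴸ-cong (λ t → if-χ (isPair t) (lex< t s)) (allSubsets n) ⟩
  sumᴸ (map (λ t → χ (isPair t ∧ lex< t s)) (allSubsets n))
    ≡⟨ length-filterᵇ (λ t → isPair t ∧ lex< t s) (allSubsets n) ⟨
  countSubsets n (λ t → isPair t ∧ lex< t s) ∎
  where open ≡-Reasoning

lexRank-∷false : ∀ n (s : Subset n) → lexRank {suc n} (false ∷ s) ≡ n + lexRank s
lexRank-∷false n s = begin
  lexRank (false ∷ s)
    ≡⟨ trans (lexRank≡count (suc n) (false ∷ s)) (countSubsets-suc n _) ⟩
  countSubsets n (λ t → isPair (true ∷ t) ∧ true) + countSubsets n (λ t → isPair t ∧ lex< t s)
    ≡⟨ cong₂ _+_ (trans (countSubsets-cong n (λ t → trans (∧-identityʳ _) (isPair-∷ t))) (count-singletons n))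
                 (sym (lexRank≡count n s)) ⟩
  n + lexRank s ∎
  where open ≡-Reasoning

lexRank-singleton : ∀ n (j : Fin n) → lexRank {suc n} (true ∷ ⁅ j ⁆) ≡ toℕ j
lexRank-singleton n j = begin
  lexRank (true ∷ ⁅ j ⁆)
    ≡⟨ trans (lexRank≡count (suc n) (true ∷ ⁅ j ⁆)) (countSubsets-suc n _) ⟩
  countSubsets n (λ t → isPair (true ∷ t) ∧ lex< t ⁅ j ⁆) + countSubsets n (λ t → isPair t ∧ false)
    ≡⟨ cong₂ _+_ (trans (countSubsets-cong n (λ t → cong (_∧ lex< t ⁅ j ⁆) (isPair-∷ t))) (singletons-before j))
                 (countSubsets-none n _ (λ t → ∧-zeroʳ (isPair t))) ⟩
  toℕ j + 0
    ≡⟨ +-identityʳ (toℕ j) ⟩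
  toℕ j ∎
  where
  open ≡-Reasoning
  none-before-⊥ : ∀ {n} (t : Subset n) → (∣ t ∣ ≡ᵇ 0) ∧ lex< t ⊥ ≡ false
  none-before-⊥ []          = refl
  none-before-⊥ (true  ∷ t) = refl
  none-before-⊥ (false ∷ t) = none-before-⊥ t
  singletons-before : ∀ {n} (j : Fin n) → countSubsets n (λ t → (∣ t ∣ ≡ᵇ 1) ∧ lex< t ⁅ j ⁆) ≡ toℕ j
  singletons-before {suc n} zero    = trans (countSubsets-suc n _)
    (cong₂ _+_ (countSubsets-none n _ none-before-⊥) (countSubsets-none n _ (λ t → ∧-zeroʳ (∣ t ∣ ≡ᵇ 1))))
  singletons-before {suc n} (suc j) = trans (countSubsets-suc n _)
    (cong₂ _+_ (trans (countSubsets-cong n (λ t → ∧-identityʳ (∣ t ∣ ≡ᵇ 0))) (count-empty n)) (singletons-before j))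

<ᵇ-∸ : ∀ n r m → (n + r <ᵇ m) ≡ (r <ᵇ m ∸ n)
<ᵇ-∸ zero    r m       = refl
<ᵇ-∸ (suc n) r zero    = refl
<ᵇ-∸ (suc n) r (suc m) = <ᵇ-∸ n r m

lexGraph-tail : ∀ n m → ∀ i j → tailᴳ (lexGraph (suc n) m) i j ≡ lexGraph n (m ∸ n) i j
lexGraph-tail n m i j rewrite lexRank-∷false n (⁅ i ⁆ ∪ˢ ⁅ j ⁆) | <ᵇ-∸ n (lexRank (⁅ i ⁆ ∪ˢ ⁅ j ⁆)) m
  with i Fin.≟ j
... | yes _ = refl
... | no  _ = refl

lexGraph-head : ∀ n m (j : Fin n) → nbr (lexGraph (suc n) m) zero (suc j) ≡ (toℕ j <ᵇ m)
lexGraph-head n m j rewrite ∪-identityˡ ⁅ j ⁆ | ∪-identityʳ ⁅ j ⁆ | lexRank-singleton n j = ∨-idem (toℕ j <ᵇ m)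

lexGraph-edgeless : ∀ n (i j : Fin n) → lexGraph n 0 i j ≡ false
lexGraph-edgeless n i j with ⌊ i Fin.≟ j ⌋
... | true  = refl
... | false = refl

-- Domination and Kelmans shifts

Dominates : ∀ {n} → Pred n → Graph n → Fin n → Set
Dominates A G v = ∀ x y → (A ∖ ｛ v ｝) x ≡ true → (A ∖ ｛ v ｝) y ≡ true → G x y ≡ true → G v y ≡ true

Violation : ∀ {n} → Pred n → Graph n → Fin n → Set
Violation {n} A G v = Σ (Fin n) λ x → Σ (Fin n) λ y →
  (A ∖ ｛ v ｝) x ≡ true × (A ∖ ｛ v ｝) y ≡ true × G x y ≡ true × G v y ≡ false

dominates? : ∀ {n} (A : Pred n) (G : Graph n) v → Dominates A G v ⊎ Violation A G v
dominates? {n} A G v with any? (λ x → any? (λ y → violates x y Bool.≟ true))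
  where
  violates : Fin n → Fin n → Bool
  violates x y = (A ∖ ｛ v ｝) x ∧ ((A ∖ ｛ v ｝) y ∧ (G x y ∧ not (G v y)))
... | yes (x , y , violated) = inj₂ (x , y , ∧-trueˡ violated , ∧-trueˡ y-part , ∧-trueˡ edge-part , not-true (∧-trueʳ edge-part))
  where
  y-part : (A ∖ ｛ v ｝) y ∧ (G x y ∧ not (G v y)) ≡ true
  y-part = ∧-trueʳ {a = (A ∖ ｛ v ｝) x} violated
  edge-part : G x y ∧ not (G v y) ≡ true
  edge-part = ∧-trueʳ {a = (A ∖ ｛ v ｝) y} y-part
... | no none = inj₁ dominated
  where
  dominated : Dominates A G v
  dominated x y A'x A'y Gxy with G v y in Gvy
  ... | true  = refl
  ... | false = ⊥-elim (none (x , y , violated))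
    where
    violated : (A ∖ ｛ v ｝) x ∧ ((A ∖ ｛ v ｝) y ∧ (G x y ∧ not (G v y))) ≡ true
    violated rewrite A'x | A'y | Gxy | Gvy = refl

module Domination {n} {A : Pred n} {G : Graph n} (simple : IsSimple G) {v} (Av : A v ≡ true)
                  (dominated : Dominates A G v) where

  open IsSimple simple renaming (sym to G-sym; irrefl to G-irrefl)

  A' D : Pred n
  A' = A ∖ ｛ v ｝
  D = A' ∩ G v

  private
    no-edge-to-non-nbr : ∀ i j → A' i ≡ true → A' j ≡ true → G v j ≡ false → G i j ≡ false
    no-edge-to-non-nbr i j A'i A'j Gvj with G i j in Gij
    ... | false = refl
    ... | true  = ⊥-elim (not-¬ Gvj (dominated i j A'i A'j Gij))

  others-isolated : ∀ z y → (A' ∖ D) z ≡ true → A' y ≡ true → nbr G z y ≡ false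
  others-isolated z y z∈A'∖D A'y = cong₂ _∨_ (trans (G-sym z y) Gyz) Gyz
    where
    A'z : A' z ≡ true
    A'z = ∧-trueˡ z∈A'∖D
    Gvz : G v z ≡ false
    Gvz = not-true (subst (λ a → not (a ∧ G v z) ≡ true) A'z (∧-trueʳ {a = A' z} z∈A'∖D))
    Gyz : G y z ≡ false
    Gyz = no-edge-to-non-nbr y z A'y A'z Gvz

  non-nbrs : ∀ j → (A' ∖ nbr G v) j ≡ (A' ∖ G v) j
  non-nbrs j = cong (λ b → A' j ∧ not b) (trans (cong (G v j ∨_) (G-sym j v)) (∨-idem (G v j)))

  non-nbrs-independent : ∀ i j → (A' ∖ G v) i ≡ true → (A' ∖ G v) j ≡ true → G i j ≡ false
  non-nbrs-independent i j i∈ j∈ = no-edge-to-non-nbr i j (∧-trueˡ i∈) (∧-trueˡ j∈) (not-true (∧-trueʳ {a = A' j} j∈))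

  card-non-nbrs : card (A' ∖ G v) ≡ card (A' ∖ D)
  card-non-nbrs = card-cong (λ i → ∖∩ (A' i) (G v i))
    where
    ∖∩ : ∀ a g → a ∧ not g ≡ a ∧ not (a ∧ g)
    ∖∩ false _ = refl
    ∖∩ true  _ = refl

  card-nbrs : card (A' ∖ (A' ∖ G v)) ≡ card D
  card-nbrs = card-cong (λ i → ∖∖ (A' i) (G v i))
    where
    ∖∖ : ∀ a g → a ∧ not (a ∧ not g) ≡ a ∧ g
    ∖∖ false _     = refl
    ∖∖ true  false = refl
    ∖∖ true  true  = refl

  card-D< : card D < card A
  card-D< = subst (card D <_) (sym (card-remove A Av)) (s≤s (card-mono {P = D} {Q = A'} (λ _ → ∧-trueˡ)))

  card-A : card (A' ∖ D) + suc (card D) ≡ card A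
  card-A = begin
    card (A' ∖ D) + suc (card D)          ≡⟨ +-suc (card (A' ∖ D)) (card D) ⟩
    suc (card (A' ∖ D) + card D)          ≡⟨ cong suc (+-comm (card (A' ∖ D)) (card D)) ⟩
    suc (card D + card (A' ∖ D))          ≡⟨ cong (λ x → suc (card D + x)) card-non-nbrs ⟨
    suc (card D + card (A' ∖ G v))        ≡⟨ cong suc (card-split A' (G v)) ⟨
    suc (card A')                         ≡⟨ card-remove A Av ⟨
    card A                                ∎
    where open ≡-Reasoning

  edgesIn-A : card D + edgesIn D G ≡ edgesIn A G
  edgesIn-A = begin
    card D + edgesIn D G           ≡⟨ +-comm (card D) (edgesIn D G) ⟩
    edgesIn D G + card D           ≡⟨ cong₂ _+_ edges-within degree ⟨
    edgesIn A' G + degIn A G v     ≡⟨ edgesIn-remove A G Av simple ⟨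
    edgesIn A G                    ∎
    where
    open ≡-Reasoning
    edges-within : edgesIn A' G ≡ edgesIn D G
    edges-within = sum-cong-≗ λ i → sum-cong-≗ λ j → cong χ (same-edge i j)
      where
      same-edge : ∀ i j → edge A' G i j ≡ edge D G i j
      same-edge i j with A' i in A'i | A' j in A'j
      ... | false | _     = refl
      ... | true  | false = cong ((i <ᶠ j) ∧_) (sym (∧-zeroʳ (G v i)))
      ... | true  | true with G i j in Gij
      ...   | false rewrite ∧-zeroʳ (G v j) | ∧-zeroʳ (G v i) = refl
      ...   | true  rewrite dominated i j A'i A'j Gij | dominated j i A'j A'i (trans (G-sym j i) Gij) = refl
    degree : degIn A G v ≡ card D
    degree = card-cong pointwise
      where
      pointwise : ∀ j → A j ∧ G v j ≡ A' j ∧ G v j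
      pointwise j with ==-dec j v
      ... | inj₁ refl = trans (cong (A j ∧_) (G-irrefl j))
                              (trans (∧-zeroʳ (A j)) (sym (trans (cong (A' j ∧_) (G-irrefl j)) (∧-zeroʳ (A' j)))))
      ... | inj₂ j≠v rewrite j≠v | ∧-identityʳ (A j) = refl

moved : ∀ {n} → Graph n → Fin n → Fin n → Pred n
moved G v u w = not (w == v) ∧ (not (w == u) ∧ (G u w ∧ not (G v w)))

-- v takes over every neighbour of u that it did not have; everything else is unchanged.
shift : ∀ {n} → Graph n → Fin n → Fin n → Graph n
shift G v u i j =
  if i == v then G v j ∨ moved G v u j
  else if j == v then G i v ∨ moved G v u i
  else if i == u then G u j ∧ not (moved G v u j)
  else if j == u then G i u ∧ not (moved G v u i)
  else G i j

module Shift {n} {G : Graph n} {v u : Fin n} (u≠v : (u == v) ≡ false) (simple : IsSimple G) where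

  open IsSimple simple renaming (sym to G-sym; irrefl to G-irrefl)

  S : Graph n
  S = shift G v u

  moved-u : moved G v u u ≡ false
  moved-u rewrite ==-refl u = ∧-zeroʳ (not (u == v))

  shift-v-row : ∀ j → S v j ≡ G v j ∨ moved G v u j
  shift-v-row j rewrite ==-refl v = refl

  shift-v-col : ∀ i → (i == v) ≡ false → S i v ≡ G i v ∨ moved G v u i
  shift-v-col i i≠v rewrite i≠v | ==-refl v = refl

  shift-u-row : ∀ j → (j == v) ≡ false → S u j ≡ G u j ∧ not (moved G v u j)
  shift-u-row j j≠v rewrite u≠v | j≠v | ==-refl u = refl

  shift-u-col : ∀ i → (i == v) ≡ false → (i == u) ≡ false → S i u ≡ G i u ∧ not (moved G v u i)
  shift-u-col i i≠v i≠u rewrite i≠v | u≠v | i≠u | ==-refl u = refl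

  shift-elsewhere : ∀ i j → (i == v) ≡ false → (i == u) ≡ false → (j == v) ≡ false → (j == u) ≡ false →
    S i j ≡ G i j
  shift-elsewhere i j i≠v i≠u j≠v j≠u rewrite i≠v | i≠u | j≠v | j≠u = refl

  shift-isSimple : IsSimple S
  shift-isSimple = record { sym = S-sym ; irrefl = S-irrefl }
    where
    S-sym : ∀ i j → S i j ≡ S j i
    S-sym i j with i == v in i=v | j == v in j=v
    ... | true  | true  rewrite ==⇒≡ i v i=v | ==⇒≡ j v j=v = refl
    ... | true  | false rewrite G-sym v j = refl
    ... | false | true  rewrite G-sym v i = refl
    ... | false | false with i == u in i=u | j == u in j=u
    ...   | true  | true  rewrite ==⇒≡ i u i=u | ==⇒≡ j u j=u = refl
    ...   | true  | false rewrite G-sym u j = refl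
    ...   | false | true  rewrite G-sym u i = refl
    ...   | false | false = G-sym i j
    S-irrefl : ∀ i → S i i ≡ false
    S-irrefl i with i == v in i=v
    ... | true rewrite ==⇒≡ i v i=v | G-irrefl v = refl
    ... | false with i == u in i=u
    ...   | true rewrite ==⇒≡ i u i=u | G-irrefl u = refl
    ...   | false = G-irrefl i

  nbr-shift-vu : nbr S v u ≡ nbr G v u
  nbr-shift-vu rewrite shift-v-row u | shift-v-col u u≠v | moved-u =
    cong₂ _∨_ (∨-identityʳ (G v u)) (∨-identityʳ (G u v))

  module _ j (j≠v : (j == v) ≡ false) (j≠u : (j == u) ≡ false) where

    nbr-shift-v : nbr S v j ≡ nbr G v j ∨ nbr G u j
    nbr-shift-v rewrite shift-v-row j | shift-v-col j j≠v | j≠v | j≠u | G-sym j v | G-sym j u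
      with G v j | G u j
    ... | false | false = refl
    ... | false | true  = refl
    ... | true  | _     = refl

    nbr-shift-u : nbr S u j ≡ nbr G v j ∧ nbr G u j
    nbr-shift-u rewrite shift-u-row j j≠v | shift-u-col j j≠v j≠u | j≠v | j≠u | G-sym j v | G-sym j u
      with G v j | G u j
    ... | false | false = refl
    ... | false | true  = refl
    ... | true  | false = refl
    ... | true  | true  = refl

  module _ (A : Pred n) (Av : A v ≡ true) (Au : A u ≡ true) where

    private
      A' A'' : Pred n
      A' = A ∖ ｛ v ｝
      A'' = A' ∖ ｛ u ｝
      A'u : A' u ≡ true
      A'u rewrite Au | u≠v = refl

    off-vu : ∀ j → A'' j ≡ true → (j == v) ≡ false × (j == u) ≡ false
    off-vu j A''j = removed-≢ A (∧-trueˡ A''j) , removed-≢ A' A''j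

    shift-agrees-within : ∀ U → U ⊆ A'' → ∀ i j → U i ≡ true → U j ≡ true → S i j ≡ G i j
    shift-agrees-within U U⊆A'' i j Ui Uj with off-vu i (U⊆A'' i Ui) | off-vu j (U⊆A'' j Uj)
    ... | i≠v , i≠u | j≠v , j≠u = shift-elsewhere i j i≠v i≠u j≠v j≠u

    degIn-shift : degIn A' S u + degIn A S v ≡ degIn A' G u + degIn A G v
    degIn-shift = trans (sym (∑-distrib-+ (χ ∘ (A' ∩ S u)) (χ ∘ (A ∩ S v))))
                 (trans (sum-cong-≗ pointwise) (∑-distrib-+ (χ ∘ (A' ∩ G u)) (χ ∘ (A ∩ G v))))
      where
      pointwise : ∀ j → χ (A' j ∧ S u j) + χ (A j ∧ S v j) ≡ χ (A' j ∧ G u j) + χ (A j ∧ G v j)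
      pointwise j with ==-dec j v
      ... | inj₁ refl = trans (cong₂ (λ a s → χ (a ∧ S u j) + χ (A j ∧ s)) (remove-self A j) (IsSimple.irrefl shift-isSimple j))
                              (sym (cong₂ (λ a g → χ (a ∧ G u j) + χ (A j ∧ g)) (remove-self A j) (G-irrefl j)))
      ... | inj₂ j≠v  = trans (cong₂ (λ s t → χ (A' j ∧ s) + χ (A j ∧ t)) (shift-u-row j j≠v) (shift-v-row j))
                              (moving (A j) (j == v) (j == u) (G u j) (G v j) j≠v)
        where
        moving : ∀ a w e gu gv → w ≡ false →
          χ ((a ∧ not w) ∧ (gu ∧ not (not w ∧ (not e ∧ (gu ∧ not gv))))) + χ (a ∧ (gv ∨ (not w ∧ (not e ∧ (gu ∧ not gv)))))
            ≡ χ ((a ∧ not w) ∧ gu) + χ (a ∧ gv)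
        moving false _ _     _     _     refl = refl
        moving true  _ false false false refl = refl
        moving true  _ false false true  refl = refl
        moving true  _ false true  false refl = refl
        moving true  _ false true  true  refl = refl
        moving true  _ true  false false refl = refl
        moving true  _ true  false true  refl = refl
        moving true  _ true  true  false refl = refl
        moving true  _ true  true  true  refl = refl

    edgesIn-shift : edgesIn A S ≡ edgesIn A G
    edgesIn-shift = begin
      edgesIn A S                                     ≡⟨ edgesIn-remove A S Av shift-isSimple ⟩
      edgesIn A' S + degIn A S v                      ≡⟨ cong (_+ degIn A S v) (edgesIn-remove A' S A'u shift-isSimple) ⟩
      edgesIn A'' S + degIn A' S u + degIn A S v      ≡⟨ +-assoc (edgesIn A'' S) _ _ ⟩
      edgesIn A'' S + (degIn A' S u + degIn A S v)    ≡⟨ cong₂ _+_ (edgesIn-congᴳ A'' S G (shift-agrees-within A'' (λ _ A''i → A''i))) degIn-shift ⟩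
      edgesIn A'' G + (degIn A' G u + degIn A G v)    ≡⟨ +-assoc (edgesIn A'' G) _ _ ⟨
      edgesIn A'' G + degIn A' G u + degIn A G v      ≡⟨ cong (_+ degIn A G v) (edgesIn-remove A' G A'u simple) ⟨
      edgesIn A' G + degIn A G v                      ≡⟨ edgesIn-remove A G Av simple ⟨
      edgesIn A G                                     ∎
      where open ≡-Reasoning

    edgesIn-shift-others : ∀ y → A' y ≡ true → (y == u) ≡ false → G u y ≡ true → G v y ≡ false →
      edgesIn A' S < edgesIn A' G
    edgesIn-shift-others y A'y y≠u Guy Gvy = +-cancelʳ-< (degIn A G v) (edgesIn A' S) (edgesIn A' G) (begin-strict
      edgesIn A' S + degIn A G v    <⟨ +-monoʳ-< (edgesIn A' S) degree-grows ⟩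
      edgesIn A' S + degIn A S v    ≡⟨ edgesIn-remove A S Av shift-isSimple ⟨
      edgesIn A S                   ≡⟨ edgesIn-shift ⟩
      edgesIn A G                   ≡⟨ edgesIn-remove A G Av simple ⟩
      edgesIn A' G + degIn A G v    ∎)
      where
      open ≤-Reasoning
      degree-grows : degIn A G v < degIn A S v
      degree-grows = card-strict {P = A ∩ G v} {Q = A ∩ S v}
        (λ j A∩Gv → trans (cong (A j ∧_) (shift-v-row j)) (∨-introˡ (A j) A∩Gv)) y
        (trans (cong (A y ∧_) Gvy) (∧-zeroʳ (A y)))
        (trans (cong (A y ∧_) (shift-v-row y)) Sv-y)
        where
        ∨-introˡ : ∀ a {g m} → a ∧ g ≡ true → a ∧ (g ∨ m) ≡ true
        ∨-introˡ true {true} _ = refl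
        Sv-y : A y ∧ (G v y ∨ moved G v u y) ≡ true
        Sv-y rewrite Gvy | removed-≢ A A'y | y≠u | Guy = trans (∧-identityʳ (A y)) (∧-trueˡ A'y)

data Position : ℕ → ℕ → Set where
  within : ∀ m d → Position (m + d) m
  beyond : ∀ k y → Position k (suc k + y)

position : ∀ k m → Position k m
position k       zero    = within 0 k
position zero    (suc m) = beyond 0 m
position (suc k) (suc m) with position k m
... | within m d = within (suc m) d
... | beyond k y = beyond (suc k) y

module _ (p q : ℕ) where

  -- The weighted independence sum

  vertexWeight : Bool → Bool → ℕ
  vertexWeight false _     = 1
  vertexWeight true  false = p
  vertexWeight true  true  = q

  weight : ∀ {n} → Pred n → Vec Bool n → ℕ
  weight A []      = 1
  weight A (x ∷ τ) = vertexWeight (A zero) x * weight (A ∘ suc) τ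

  summand : ∀ {n} → Pred n → Pred n → Graph n → Vec Bool n → ℕ
  summand A U G τ = if (τ ⊆ᵇ U) ∧ independent G τ then weight A τ else 0

  -- Z A U G = Σ p^|A ∖ τ| q^|τ| over the independent sets τ ⊆ U of G; vertices outside A weigh 1.
  -- hom(G, S°(p,q)) = Z full full G (hom-Sloop).
  Z : ∀ {n} → Pred n → Pred n → Graph n → ℕ
  Z {n} A U G = ∑ᴮ n (summand A U G)

  weight-cong : ∀ {n} {A B : Pred n} → (∀ i → A i ≡ B i) → ∀ τ → weight A τ ≡ weight B τ
  weight-cong A≗B []      = refl
  weight-cong A≗B (x ∷ τ) = cong₂ (λ a w → vertexWeight a x * w) (A≗B zero) (weight-cong (A≗B ∘ suc) τ)

  weight-remove : ∀ {n} (A : Pred n) {v} τ → A v ≡ true → lookup τ v ≡ false →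
    weight A τ ≡ p * weight (A ∖ ｛ v ｝) τ
  weight-remove A {zero} (false ∷ τ) Av _ rewrite Av =
    cong (p *_) (trans (weight-cong (λ i → sym (∧-identityʳ (A (suc i)))) τ) (sym (+-identityʳ _)))
  weight-remove A {suc v} (x ∷ τ) Av τv
    rewrite weight-remove (A ∘ suc) τ Av τv | ∧-identityʳ (A zero) =
    *-leftComm (vertexWeight (A zero) x) p (weight ((A ∘ suc) ∖ ｛ v ｝) τ)

  weight-insert : ∀ {n} (A : Pred n) {v} τ → A v ≡ true → lookup τ v ≡ false →
    weight A (τ [ v ]≔ true) ≡ q * weight (A ∖ ｛ v ｝) τ
  weight-insert A {zero} (false ∷ τ) Av _ rewrite Av =
    cong (q *_) (trans (weight-cong (λ i → sym (∧-identityʳ (A (suc i)))) τ) (sym (+-identityʳ _)))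
  weight-insert A {suc v} (x ∷ τ) Av τv
    rewrite weight-insert (A ∘ suc) τ Av τv | ∧-identityʳ (A zero) =
    *-leftComm (vertexWeight (A zero) x) q (weight ((A ∘ suc) ∖ ｛ v ｝) τ)

  Z-cong : ∀ {n} {A A' U U' : Pred n} (G : Graph n) → (∀ i → A i ≡ A' i) → (∀ i → U i ≡ U' i) →
    Z A U G ≡ Z A' U' G
  Z-cong {n} G A≗A' U≗U' = ∑ᴮ-cong n (λ τ →
    cong₂ (λ s w → if s ∧ independent G τ then w else 0) (⊆ᵇ-cong U≗U' τ) (weight-cong A≗A' τ))

  Z-congᴳ : ∀ {n} (A U : Pred n) (G G' : Graph n) → (∀ i j → U i ≡ true → U j ≡ true → G i j ≡ G' i j) →
    Z A U G ≡ Z A U G'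
  Z-congᴳ {n} A U G G' G≗G' = ∑ᴮ-cong n same
    where
    same : ∀ τ → summand A U G τ ≡ summand A U G' τ
    same τ with τ ⊆ᵇ U in τ⊆U
    ... | false = refl
    ... | true rewrite independent-congOn U G G' G≗G' τ τ⊆U = refl

  Z-split : ∀ {n} (A U : Pred n) (G : Graph n) {v} → A v ≡ true → G v v ≡ false →
    Z A U G ≡ p * Z (A ∖ ｛ v ｝) (U ∖ ｛ v ｝) G
            + (if U v then q * Z (A ∖ ｛ v ｝) (U ∖ ｛ v ｝ ∖ nbr G v) G else 0)
  Z-split {n} A U G {v} Av Gvv = begin
    Z A U G
      ≡⟨ ∑ᴮ-split n v (summand A U G) ⟩
    ∑ᴮ n (λ τ → if lookup τ v then 0 else summand A U G τ)
      + ∑ᴮ n (λ τ → if lookup τ v then 0 else summand A U G (τ [ v ]≔ true))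
      ≡⟨ cong₂ _+_ (trans (∑ᴮ-cong n v-out) (*-distribˡ-∑ᴮ n p _)) (∑ᴮ-cong n v-in) ⟩
    p * Z A' (U ∖ ｛ v ｝) G + ∑ᴮ n (λ τ → if U v then q * summand A' U'' G τ else 0)
      ≡⟨ cong (p * Z A' (U ∖ ｛ v ｝) G +_) (∑ᴮ-if (U v)) ⟩
    p * Z A' (U ∖ ｛ v ｝) G + (if U v then q * Z A' U'' G else 0) ∎
    where
    open ≡-Reasoning
    A' U'' : Pred n
    A' = A ∖ ｛ v ｝
    U'' = U ∖ ｛ v ｝ ∖ nbr G v
    v-out : ∀ τ → (if lookup τ v then 0 else summand A U G τ) ≡ p * summand A' (U ∖ ｛ v ｝) G τ
    v-out τ with lookup τ v in τv
    ... | true rewrite ⊆ᵇ-outside (U ∖ ｛ v ｝) τ τv (remove-self U v) = sym (*-zeroʳ p)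
    ... | false rewrite sym (⊆ᵇ-remove U τ τv) | weight-remove A τ Av τv =
      if-then-* ((τ ⊆ᵇ U) ∧ independent G τ) p (weight A' τ)
    v-in : ∀ τ → (if lookup τ v then 0 else summand A U G (τ [ v ]≔ true))
               ≡ (if U v then q * summand A' U'' G τ else 0)
    v-in τ with lookup τ v in τv
    ... | true rewrite ⊆ᵇ-outside U'' τ τv (cong (_∧ not (nbr G v v)) (remove-self U v)) with U v
    ...   | false = refl
    ...   | true  = sym (*-zeroʳ q)
    v-in τ | false
      rewrite ⊆ᵇ-insert U v τ | independent-insert G v τ | weight-insert A τ Av τv | Gvv
            | ⊆ᵇ-∩ (U ∖ ｛ v ｝) (λ j → not (nbr G v j)) τ | sym (⊆ᵇ-remove U τ τv)
      = regroup (U v) (τ ⊆ᵇ U) (τ ⊆ᵇ λ j → not (nbr G v j)) (independent G τ)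
      where
      regroup : ∀ a b c d → (if (a ∧ b) ∧ (c ∧ d) then q * weight A' τ else 0)
                          ≡ (if a then q * (if (b ∧ c) ∧ d then weight A' τ else 0) else 0)
      regroup false b     c     d     = refl
      regroup true  false c     d     = sym (*-zeroʳ q)
      regroup true  true  false d     = sym (*-zeroʳ q)
      regroup true  true  true  false = sym (*-zeroʳ q)
      regroup true  true  true  true  = refl
    ∑ᴮ-if : ∀ b → ∑ᴮ n (λ τ → if b then q * summand A' U'' G τ else 0) ≡ (if b then q * Z A' U'' G else 0)
    ∑ᴮ-if false = ∑ᴮ-zero n
    ∑ᴮ-if true  = *-distribˡ-∑ᴮ n q _

  Z-exchange : ∀ {n} (A : Pred n) (G : Graph n) {U₁ U₂ U₃ : Pred n} → U₁ ⊆ U₃ → U₂ ⊆ U₃ →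
    Z A U₁ G + Z A U₂ G ≤ Z A (U₁ ∩ U₂) G + Z A U₃ G
  Z-exchange {n} A G {U₁} {U₂} {U₃} U₁⊆U₃ U₂⊆U₃ =
    subst₂ _≤_ (∑ᴮ-distrib-+ n (summand A U₁ G) (summand A U₂ G))
               (∑ᴮ-distrib-+ n (summand A (U₁ ∩ U₂) G) (summand A U₃ G))
               (∑ᴮ-mono-≤ n pointwise)
    where
    pointwise : ∀ τ → summand A U₁ G τ + summand A U₂ G τ ≤ summand A (U₁ ∩ U₂) G τ + summand A U₃ G τ
    pointwise τ rewrite ⊆ᵇ-∩ U₁ U₂ τ with τ ⊆ᵇ U₁ in τ⊆U₁ | τ ⊆ᵇ U₂ in τ⊆U₂
    ... | false | false = z≤n
    ... | true  | false rewrite ⊆ᵇ-mono U₁⊆U₃ τ τ⊆U₁ = ≤-reflexive (+-comm _ 0)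
    ... | false | true  rewrite ⊆ᵇ-mono U₂⊆U₃ τ τ⊆U₂ = ≤-refl
    ... | true  | true  rewrite ⊆ᵇ-mono U₂⊆U₃ τ τ⊆U₂ = ≤-refl

  Z-exchange-∖ : ∀ {n} (A : Pred n) (G : Graph n) (N M : Pred n) →
    Z A (A ∖ N) G + Z A (A ∖ M) G ≤ Z A (A ∖ (N ∪ M)) G + Z A (A ∖ (N ∩ M)) G
  Z-exchange-∖ A G N M = subst (λ t → Z A (A ∖ N) G + Z A (A ∖ M) G ≤ t + Z A (A ∖ (N ∩ M)) G)
    (Z-cong G (λ _ → refl) (λ j → both (A j) (N j) (M j)))
    (Z-exchange A G (λ j → weaken (A j) (N j) (M j)) (λ j → weaken′ (A j) (N j) (M j)))
    where
    both : ∀ a x y → (a ∧ not x) ∧ (a ∧ not y) ≡ a ∧ not (x ∨ y)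
    both false _ _ = refl
    both true  x y = sym (deMorgan₂ x y)
    weaken : ∀ a x y → a ∧ not x ≡ true → a ∧ not (x ∧ y) ≡ true
    weaken true false _ _ = refl
    weaken′ : ∀ a x y → a ∧ not y ≡ true → a ∧ not (x ∧ y) ≡ true
    weaken′ true false false _ = refl
    weaken′ true true  false _ = refl

  ∑ᴮ-weight-⊆ : ∀ {n} (A U : Pred n) → U ⊆ A →
    ∑ᴮ n (λ τ → if τ ⊆ᵇ U then weight A τ else 0) ≡ p ^ card (A ∖ U) * (p + q) ^ card U
  ∑ᴮ-weight-⊆ {zero}  A U U⊆A = refl
  ∑ᴮ-weight-⊆ {suc n} A U U⊆A = begin
    ∑ᴮ n (λ σ → if σ ⊆ᵇ U ∘ suc then vertexWeight (A zero) false * weight (A ∘ suc) σ else 0)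
      + ∑ᴮ n (λ σ → if U zero ∧ (σ ⊆ᵇ U ∘ suc) then vertexWeight (A zero) true * weight (A ∘ suc) σ else 0)
      ≡⟨ cong₂ _+_ (pull (vertexWeight (A zero) false)) (pull-if (U zero) (vertexWeight (A zero) true)) ⟩
    vertexWeight (A zero) false * S + (if U zero then vertexWeight (A zero) true * S else 0)
      ≡⟨ cong (λ s → vertexWeight (A zero) false * s + (if U zero then vertexWeight (A zero) true * s else 0))
              (∑ᴮ-weight-⊆ (A ∘ suc) (U ∘ suc) (U⊆A ∘ suc)) ⟩
    vertexWeight (A zero) false * (p ^ c * (p + q) ^ d) + (if U zero then vertexWeight (A zero) true * (p ^ c * (p + q) ^ d) else 0)
      ≡⟨ head-factor (A zero) (U zero) (U⊆A zero) ⟩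
    p ^ (χ (A zero ∧ not (U zero)) + c) * (p + q) ^ (χ (U zero) + d) ∎
    where
    open ≡-Reasoning
    S c d : ℕ
    S = ∑ᴮ n (λ σ → if σ ⊆ᵇ U ∘ suc then weight (A ∘ suc) σ else 0)
    c = card ((A ∘ suc) ∖ (U ∘ suc))
    d = card (U ∘ suc)
    pull : ∀ x → ∑ᴮ n (λ σ → if σ ⊆ᵇ U ∘ suc then x * weight (A ∘ suc) σ else 0) ≡ x * S
    pull x = trans (∑ᴮ-cong n (λ σ → if-then-* (σ ⊆ᵇ U ∘ suc) x _)) (*-distribˡ-∑ᴮ n x _)
    pull-if : ∀ u x → ∑ᴮ n (λ σ → if u ∧ (σ ⊆ᵇ U ∘ suc) then x * weight (A ∘ suc) σ else 0) ≡ (if u then x * S else 0)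
    pull-if false _ = ∑ᴮ-zero n
    pull-if true  x = pull x
    head-factor : ∀ a u → (u ≡ true → a ≡ true) →
      vertexWeight a false * (p ^ c * (p + q) ^ d) + (if u then vertexWeight a true * (p ^ c * (p + q) ^ d) else 0)
        ≡ p ^ (χ (a ∧ not u) + c) * (p + q) ^ (χ u + d)
    head-factor false false _   = trans (+-identityʳ _) (*-identityˡ _)
    head-factor false true  u⇒a with () ← u⇒a refl
    head-factor true  false _   = arith p (p ^ c) ((p + q) ^ d)
      where
      arith : ∀ p P R → p * (P * R) + 0 ≡ p * P * R
      arith = solve-∀
    head-factor true  true  _   = arith p q (p ^ c) ((p + q) ^ d)
      where
      arith : ∀ p q P R → p * (P * R) + q * (P * R) ≡ P * ((p + q) * R)
      arith = solve-∀

  Z-independent : ∀ {n} (A U : Pred n) (G : Graph n) → U ⊆ A →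
    (∀ i j → U i ≡ true → U j ≡ true → G i j ≡ false) →
    Z A U G ≡ p ^ card (A ∖ U) * (p + q) ^ card U
  Z-independent {n} A U G U⊆A U-indep = trans (∑ᴮ-cong n drop-independence) (∑ᴮ-weight-⊆ A U U⊆A)
    where
    drop-independence : ∀ τ → summand A U G τ ≡ (if τ ⊆ᵇ U then weight A τ else 0)
    drop-independence τ with τ ⊆ᵇ U in τ⊆U
    ... | false = refl
    ... | true rewrite independent-within U G U-indep τ τ⊆U = refl

  Z-removeIsolated : ∀ {n} (A : Pred n) (G : Graph n) {z} → A z ≡ true →
    (∀ y → A y ≡ true → nbr G z y ≡ false) →
    Z A A G ≡ (p + q) * Z (A ∖ ｛ z ｝) (A ∖ ｛ z ｝) G
  Z-removeIsolated {n} A G {z} Az z-isolated = begin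
    Z A A G
      ≡⟨ Z-split A A G Az (∨-falseˡ (z-isolated z Az)) ⟩
    p * Z A' A' G + (if A z then q * Z A' (A' ∖ nbr G z) G else 0)
      ≡⟨ cong (λ a → p * Z A' A' G + (if a then q * Z A' (A' ∖ nbr G z) G else 0)) Az ⟩
    p * Z A' A' G + q * Z A' (A' ∖ nbr G z) G
      ≡⟨ cong (λ x → p * Z A' A' G + q * x) (Z-cong G (λ _ → refl) no-neighbours) ⟩
    p * Z A' A' G + q * Z A' A' G
      ≡⟨ sym (*-distribʳ-+ (Z A' A' G) p q) ⟩
    (p + q) * Z A' A' G ∎
    where
    open ≡-Reasoning
    A' : Pred n
    A' = A ∖ ｛ z ｝
    no-neighbours : ∀ j → (A' ∖ nbr G z) j ≡ A' j
    no-neighbours j with A j in Aj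
    ... | false = refl
    ... | true rewrite z-isolated j Aj = ∧-identityʳ _

  Z-isolated : ∀ {n} (A B : Pred n) (G : Graph n) → B ⊆ A →
    (∀ z y → (A ∖ B) z ≡ true → A y ≡ true → nbr G z y ≡ false) →
    Z A A G ≡ (p + q) ^ card (A ∖ B) * Z B B G
  Z-isolated {n} A B G B⊆A isolated = go (card (A ∖ B)) A B⊆A isolated refl
    where
    go : ∀ c A → B ⊆ A → (∀ z y → (A ∖ B) z ≡ true → A y ≡ true → nbr G z y ≡ false) →
      card (A ∖ B) ≡ c → Z A A G ≡ (p + q) ^ c * Z B B G
    go zero A B⊆A _ empty = trans (Z-cong G A≗B A≗B) (sym (+-identityʳ _))
      where
      A≗B : ∀ i → A i ≡ B i
      A≗B i with B i in Bi
      ... | true  = B⊆A i Bi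
      ... | false = trans (sym (∧-identityʳ (A i)))
                          (trans (cong (λ b → A i ∧ not b) (sym Bi)) (card≡0⇒empty (A ∖ B) empty i))
    go (suc c) A B⊆A isolated count with card≡suc⇒nonempty (A ∖ B) count
    ... | z , z∈A∖B = begin
      Z A A G                                ≡⟨ Z-removeIsolated A G Az (λ y → isolated z y z∈A∖B) ⟩
      (p + q) * Z A' A' G                    ≡⟨ cong ((p + q) *_) (go c A' B⊆A' isolated' count') ⟩
      (p + q) * ((p + q) ^ c * Z B B G)      ≡⟨ sym (*-assoc (p + q) _ _) ⟩
      (p + q) ^ suc c * Z B B G              ∎
      where
      open ≡-Reasoning
      A' : Pred n
      A' = A ∖ ｛ z ｝
      Az : A z ≡ true
      Az = ∧-trueˡ z∈A∖B
      Bz : B z ≡ false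
      Bz = not-true (∧-trueʳ z∈A∖B)
      B⊆A' : B ⊆ A'
      B⊆A' i Bi with i == z in i=z
      ... | false = trans (∧-identityʳ (A i)) (B⊆A i Bi)
      ... | true rewrite ==⇒≡ i z i=z = ⊥-elim (not-¬ Bz Bi)
      isolated' : ∀ z' y → (A' ∖ B) z' ≡ true → A' y ≡ true → nbr G z' y ≡ false
      isolated' z' y z'∈A'∖B y∈A' = isolated z' y
        (∖-intro {P = A} {Q = B} (∧-trueˡ z'∈A') (not-true (∧-trueʳ {a = A' z'} z'∈A'∖B)))
        (∧-trueˡ y∈A')
        where
        z'∈A' : A' z' ≡ true
        z'∈A' = ∧-trueˡ z'∈A'∖B
      count' : card (A' ∖ B) ≡ c
      count' = suc-injective (trans (cong suc (card-cong (λ i → ∧-rightComm (A i) (not (i == z)) (not (B i)))))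
                                    (trans (sym (card-remove (A ∖ B) z∈A∖B)) count))

  -- The shape of Z after splitting off two vertices (Z-split-pair).
  splitValue : ℕ → ℕ → ℕ → Bool → ℕ → ℕ
  splitValue x y y' b z = p * (p * x + q * y) + q * (p * y' + (if b then q * z else 0))

  splitValue-cong : ∀ {x x' y y' z z' w w' b b'} → x ≡ x' → y ≡ y' → z ≡ z' → b ≡ b' → w ≡ w' →
    splitValue x y z b w ≡ splitValue x' y' z' b' w'
  splitValue-cong refl refl refl refl refl = refl

  splitValue-mono : ∀ {x y y' b z y₁ y₁'} → y' + y ≤ y₁' + y₁ → splitValue x y y' b z ≤ splitValue x y₁ y₁' b z
  splitValue-mono {x} {y} {y'} {b} {z} {y₁} {y₁'} le = subst₂ _≤_ (sym (expand y y')) (sym (expand y₁ y₁'))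
    (+-monoˡ-≤ (q * w) (+-monoʳ-≤ (p * p * x) (*-monoʳ-≤ (p * q) le)))
    where
    w : ℕ
    w = if b then q * z else 0
    expand : ∀ a a' → splitValue x a a' b z ≡ p * p * x + p * q * (a' + a) + q * w
    expand a a' = arith p q x a a' w
      where
      arith : ∀ p q x a a' w → p * (p * x + q * a) + q * (p * a' + w) ≡ p * p * x + p * q * (a' + a) + q * w
      arith = solve-∀

  module _ {n} (A : Pred n) {v u : Fin n} (Av : A v ≡ true) (Au : A u ≡ true) (u≠v : (u == v) ≡ false) where

    private
      A' A'' : Pred n
      A' = A ∖ ｛ v ｝
      A'' = A' ∖ ｛ u ｝
      A'u : A' u ≡ true
      A'u rewrite Au | u≠v = refl

    Z-split-pair : ∀ (H : Graph n) → H v v ≡ false → H u u ≡ false →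
      Z A A H ≡ splitValue (Z A'' A'' H) (Z A'' (A'' ∖ nbr H u) H) (Z A'' (A'' ∖ nbr H v) H)
                           (not (nbr H v u)) (Z A'' (A'' ∖ nbr H v ∖ nbr H u) H)
    Z-split-pair H Hvv Huu = begin
      Z A A H
        ≡⟨ Z-split A A H Av Hvv ⟩
      p * Z A' A' H + (if A v then q * Z A' (A' ∖ nbr H v) H else 0)
        ≡⟨ cong (λ a → p * Z A' A' H + (if a then q * Z A' (A' ∖ nbr H v) H else 0)) Av ⟩
      p * Z A' A' H + q * Z A' (A' ∖ nbr H v) H
        ≡⟨ cong₂ (λ x y → p * x + q * y) split-A' split-A'∖Nv ⟩
      _ ∎
      where
      open ≡-Reasoning
      split-A' : Z A' A' H ≡ p * Z A'' A'' H + q * Z A'' (A'' ∖ nbr H u) H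
      split-A' = trans (Z-split A' A' H A'u Huu)
                       (cong (λ a → p * Z A'' A'' H + (if a then q * Z A'' (A'' ∖ nbr H u) H else 0)) A'u)
      split-A'∖Nv : Z A' (A' ∖ nbr H v) H
        ≡ p * Z A'' (A'' ∖ nbr H v) H + (if not (nbr H v u) then q * Z A'' (A'' ∖ nbr H v ∖ nbr H u) H else 0)
      split-A'∖Nv = trans (Z-split A' (A' ∖ nbr H v) H A'u Huu) (cong₂ (λ x c → p * x + c)
        (Z-cong H (λ _ → refl) (λ j → ∧-rightComm (A' j) (not (nbr H v j)) (not (j == u))))
        (trans (cong (λ a → if a ∧ not (nbr H v u) then q * Z A'' ((A' ∖ nbr H v) ∖ ｛ u ｝ ∖ nbr H u) H else 0) A'u)
               (cong (λ x → if not (nbr H v u) then q * x else 0)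
                     (Z-cong H (λ _ → refl) (λ j → cong (_∧ not (nbr H u j)) (∧-rightComm (A' j) (not (nbr H v j)) (not (j == u))))))))

    Z-shift-off : ∀ (G : Graph n) → IsSimple G → (M M' : Pred n) →
      (∀ j → (j == v) ≡ false × (j == u) ≡ false → M j ≡ M' j) →
      Z A'' (λ j → A'' j ∧ M j) (shift G v u) ≡ Z A'' (λ j → A'' j ∧ M' j) G
    Z-shift-off G simple M M' M≗M' = trans (Z-cong (shift G v u) (λ _ → refl) same-set)
      (Z-congᴳ A'' (λ j → A'' j ∧ M' j) (shift G v u) G
               (shift-agrees-within A Av Au (λ j → A'' j ∧ M' j) (λ j → ∧-trueˡ {b = M' j})))
      where
      open Shift {v = v} {u = u} u≠v simple using (shift-agrees-within; off-vu)
      same-set : ∀ j → A'' j ∧ M j ≡ A'' j ∧ M' j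
      same-set j with A'' j in A''j
      ... | false = refl
      ... | true  = M≗M' j (off-vu A Av Au j A''j)

    -- Off v and u the shift changes nothing; on the rest, N(u) and N(v) become N(v) ∩ N(u) and
    -- N(v) ∪ N(u), which Z-exchange-∖ compares.
    Z-shift : ∀ (G : Graph n) → IsSimple G → Z A A G ≤ Z A A (shift G v u)
    Z-shift G simple = begin
      Z A A G
        ≡⟨ Z-split-pair G (G-irrefl v) (G-irrefl u) ⟩
      splitValue X Y Y' b (Z A'' (A'' ∖ nbr G v ∖ nbr G u) G)
        ≡⟨ cong (splitValue X Y Y' b) (Z-cong G (λ _ → refl) (λ j → ∖∖≡∖∪ (A'' j) (N₀ j) (Nᵤ j))) ⟩
      splitValue X Y Y' b Y∪
        ≤⟨ splitValue-mono (Z-exchange-∖ A'' G N₀ Nᵤ) ⟩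
      splitValue X Y∩ Y∪ b Y∪
        ≡⟨ splitValue-cong
             (Z-congᴳ A'' A'' S G (shift-agrees-within A Av Au A'' (λ _ A''i → A''i)))
             (Z-shift-off G simple (λ j → not (nbr S u j)) (λ j → not (N₀ j ∧ Nᵤ j)) (λ j (j≠v , j≠u) → cong not (nbr-shift-u j j≠v j≠u)))
             (Z-shift-off G simple (λ j → not (nbr S v j)) (λ j → not (N₀ j ∨ Nᵤ j)) (λ j (j≠v , j≠u) → cong not (nbr-shift-v j j≠v j≠u)))
             (cong not nbr-shift-vu)
             (trans (Z-cong S (λ _ → refl) (λ j → ∧-assoc (A'' j) (not (nbr S v j)) (not (nbr S u j))))
                    (Z-shift-off G simple (λ j → not (nbr S v j) ∧ not (nbr S u j)) (λ j → not (N₀ j ∨ Nᵤ j))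
                             (λ j (j≠v , j≠u) → trans (cong₂ (λ x y → not x ∧ not y) (nbr-shift-v j j≠v j≠u) (nbr-shift-u j j≠v j≠u))
                                                      (∪-absorbs-∩ (N₀ j) (Nᵤ j))))) ⟨
      splitValue (Z A'' A'' S) (Z A'' (A'' ∖ nbr S u) S) (Z A'' (A'' ∖ nbr S v) S)
                 (not (nbr S v u)) (Z A'' (A'' ∖ nbr S v ∖ nbr S u) S)
        ≡⟨ Z-split-pair S (S-irrefl v) (S-irrefl u) ⟨
      Z A A S ∎
      where
      open ≤-Reasoning
      open IsSimple simple using () renaming (irrefl to G-irrefl)
      open Shift {v = v} {u = u} u≠v simple using (S; shift-isSimple; nbr-shift-vu; nbr-shift-v; nbr-shift-u; shift-agrees-within)
      open IsSimple shift-isSimple using () renaming (irrefl to S-irrefl)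
      N₀ Nᵤ : Pred n
      N₀ = nbr G v
      Nᵤ = nbr G u
      X Y Y' Y∪ Y∩ : ℕ
      X = Z A'' A'' G
      Y = Z A'' (A'' ∖ Nᵤ) G
      Y' = Z A'' (A'' ∖ N₀) G
      Y∪ = Z A'' (A'' ∖ (N₀ ∪ Nᵤ)) G
      Y∩ = Z A'' (A'' ∖ (N₀ ∩ Nᵤ)) G
      b : Bool
      b = not (nbr G v u)
      ∪-absorbs-∩ : ∀ x y → not (x ∨ y) ∧ not (x ∧ y) ≡ not (x ∨ y)
      ∪-absorbs-∩ false false = refl
      ∪-absorbs-∩ false true  = refl
      ∪-absorbs-∩ true  _     = refl

  -- The value of the lex graph

  r : ℕ
  r = p + q

  -- Λ k m = hom(L(k,m), S°(p,q)) (Z-lexGraph): vertex 0 of L(k+1,m) is adjacent to the first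
  -- m ⊓ k other vertices, and the remaining m ∸ k edges form L(k, m ∸ k) on the others.
  Λ : ℕ → ℕ → ℕ
  Λ zero    m = 1
  Λ (suc k) m = p * Λ k (m ∸ k) + q * (p ^ (m ⊓ k) * r ^ (k ∸ m))

  Λ-edgeless : ∀ k → Λ k 0 ≡ r ^ k
  Λ-edgeless zero = refl
  Λ-edgeless (suc k) rewrite 0∸n≡0 k | Λ-edgeless k = arith p q (r ^ k)
    where
    arith : ∀ p q R → p * R + q * (1 * R) ≡ (p + q) * R
    arith = solve-∀

  Λ-suc-within : ∀ m d → Λ (suc (m + d)) m ≡ p * r ^ (m + d) + q * (p ^ m * r ^ d)
  Λ-suc-within m d
    rewrite m≤n⇒m∸n≡0 (m≤m+n m d) | Λ-edgeless (m + d) | m≤n⇒m⊓n≡m (m≤m+n m d) | m+n∸m≡n m d = refl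

  Λ-suc-within′ : ∀ m d → Λ (suc (suc (m + d))) m ≡ p * r ^ suc (m + d) + q * (p ^ m * r ^ suc d)
  Λ-suc-within′ m d = subst (λ t → Λ (suc t) m ≡ p * r ^ t + q * (p ^ m * r ^ suc d)) (+-suc m d) (Λ-suc-within m (suc d))

  Λ-suc-beyond : ∀ k y → Λ (suc k) (k + y) ≡ p * Λ k y + q * p ^ k
  Λ-suc-beyond k y
    rewrite m+n∸m≡n k y | m≥n⇒m⊓n≡n (m≤m+n k y) | m≤n⇒m∸n≡0 (m≤m+n k y) = cong (λ t → p * Λ k y + q * t) (*-identityʳ (p ^ k))

  Λ-suc-beyond′ : ∀ k y → Λ (suc k) (suc (k + y)) ≡ p * Λ k (suc y) + q * p ^ k
  Λ-suc-beyond′ k y = trans (cong (Λ (suc k)) (sym (+-suc k y))) (Λ-suc-beyond k (suc y))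

  Λ-edge-cost : ∀ k x → suc x ≤ pairs (2 + k) → Λ (2 + k) (suc x) + q * q * p ^ k ≤ Λ (2 + k) x
  Λ-edge-cost k x bound with position k x
  ... | within x d = begin
    Λ (2 + (x + d)) (suc x) + q * q * p ^ (x + d)
      ≡⟨ cong (_+ q * q * p ^ (x + d)) (Λ-suc-within (suc x) d) ⟩
    p * r ^ suc (x + d) + q * (p ^ suc x * r ^ d) + q * q * p ^ (x + d)
      ≤⟨ +-monoʳ-≤ (p * r ^ suc (x + d) + q * (p ^ suc x * r ^ d)) (*-monoʳ-≤ (q * q) p^[x+d]≤) ⟩
    p * r ^ suc (x + d) + q * (p ^ suc x * r ^ d) + q * q * (p ^ x * r ^ d)
      ≡⟨ arith p q (p * r ^ suc (x + d)) (p ^ x) (r ^ d) ⟩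
    p * r ^ suc (x + d) + q * (p ^ x * r ^ suc d)
      ≡⟨ sym (Λ-suc-within′ x d) ⟩
    Λ (2 + (x + d)) x ∎
    where
    open ≤-Reasoning
    p^[x+d]≤ : p ^ (x + d) ≤ p ^ x * r ^ d
    p^[x+d]≤ = subst (_≤ p ^ x * r ^ d) (sym (^-distribˡ-+-* p x d))
                     (*-monoʳ-≤ (p ^ x) (^-monoˡ-≤ d (m≤m+n p q)))
    arith : ∀ p q L P R → L + q * (p * P * R) + q * q * (P * R) ≡ L + q * (P * ((p + q) * R))
    arith = solve-∀
  Λ-edge-cost zero      _ (s≤s ()) | beyond _ _
  Λ-edge-cost (suc k) _ bound      | beyond _ y = begin
    Λ (3 + k) (suc (suc (suc k) + y)) + q * q * p ^ suc k
      ≡⟨ cong (_+ q * q * p ^ suc k) (Λ-suc-beyond′ (2 + k) y) ⟩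
    p * Λ (2 + k) (suc y) + q * p ^ (2 + k) + q * q * (p * p ^ k)
      ≡⟨ arith p q (Λ (2 + k) (suc y)) (q * p ^ (2 + k)) (p ^ k) ⟩
    p * (Λ (2 + k) (suc y) + q * q * p ^ k) + q * p ^ (2 + k)
      ≤⟨ +-monoˡ-≤ (q * p ^ (2 + k)) (*-monoʳ-≤ p (Λ-edge-cost k y bound′)) ⟩
    p * Λ (2 + k) y + q * p ^ (2 + k)
      ≡⟨ sym (Λ-suc-beyond (2 + k) y) ⟩
    Λ (3 + k) (suc (suc k) + y) ∎
    where
    open ≤-Reasoning
    bound′ : suc y ≤ pairs (2 + k)
    bound′ = +-cancelˡ-≤ (2 + k) (suc y) (pairs (2 + k)) (subst (_≤ pairs (3 + k)) (sym (+-suc (2 + k) y)) bound)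
    arith : ∀ p q L Q P → p * L + Q + q * q * (p * P) ≡ p * (L + q * q * P) + Q
    arith = solve-∀

  -- r * Λ k m is the value of L(k,m) together with an isolated vertex.
  Λ-vertex : ∀ k m → m ≤ pairs k → r * Λ k m ≤ Λ (suc k) m
  Λ-vertex zero zero _ = ≤-reflexive (arith p q)
    where
    arith : ∀ p q → (p + q) * 1 ≡ p * 1 + q * (1 * 1)
    arith = solve-∀
  Λ-vertex (suc k) m bound with position k m
  ... | within m d = ≤-reflexive (begin
    r * Λ (suc (m + d)) m                               ≡⟨ cong (r *_) (Λ-suc-within m d) ⟩
    r * (p * r ^ (m + d) + q * (p ^ m * r ^ d))         ≡⟨ arith p q (r ^ (m + d)) (p ^ m) (r ^ d) ⟩
    p * r ^ suc (m + d) + q * (p ^ m * r ^ suc d)       ≡⟨ sym (Λ-suc-within′ m d) ⟩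
    Λ (suc (suc (m + d))) m                             ∎)
    where
    open ≡-Reasoning
    arith : ∀ p q R P D → (p + q) * (p * R + q * (P * D)) ≡ p * ((p + q) * R) + q * (P * ((p + q) * D))
    arith = solve-∀
  Λ-vertex (suc zero)    _ ()   | beyond _ _
  Λ-vertex (suc (suc k)) _ bound | beyond _ y = begin
    r * Λ (2 + k) (suc (suc k + y))
      ≡⟨ cong (r *_) (Λ-suc-beyond′ (suc k) y) ⟩
    r * (p * Λ (suc k) (suc y) + q * (p * p ^ k))
      ≡⟨ arith p q (Λ (suc k) (suc y)) (p ^ k) ⟩
    p * (r * Λ (suc k) (suc y)) + q * (p * (p * p ^ k)) + q * q * (p * p ^ k)
      ≤⟨ +-monoˡ-≤ (q * q * (p * p ^ k)) (+-monoˡ-≤ (q * (p * (p * p ^ k)))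
           (*-monoʳ-≤ p (Λ-vertex (suc k) (suc y) bound′))) ⟩
    p * Λ (2 + k) (suc y) + q * (p * (p * p ^ k)) + q * q * (p * p ^ k)
      ≡⟨ arith′ p q (Λ (2 + k) (suc y)) (q * (p * (p * p ^ k))) (p ^ k) ⟩
    p * (Λ (2 + k) (suc y) + q * q * p ^ k) + q * p ^ (2 + k)
      ≤⟨ +-monoˡ-≤ (q * p ^ (2 + k)) (*-monoʳ-≤ p (Λ-edge-cost k y (≤-trans bound′ (m≤n+m _ (suc k))))) ⟩
    p * Λ (2 + k) y + q * p ^ (2 + k)
      ≡⟨ sym (Λ-suc-beyond (2 + k) y) ⟩
    Λ (3 + k) (suc (suc k) + y) ∎
    where
    open ≤-Reasoning
    bound′ : suc y ≤ pairs (suc k)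
    bound′ = +-cancelˡ-≤ (suc k) (suc y) (pairs (suc k)) (subst (_≤ pairs (2 + k)) (sym (+-suc (suc k) y)) bound)
    arith : ∀ p q L P → (p + q) * (p * L + q * (p * P)) ≡ p * ((p + q) * L) + q * (p * (p * P)) + q * q * (p * P)
    arith = solve-∀
    arith′ : ∀ p q L Q P → p * L + Q + q * q * (p * P) ≡ p * (L + q * q * P) + Q
    arith′ = solve-∀

  Λ-vertices : ∀ j d m → m ≤ pairs d → r ^ j * Λ d m ≤ Λ (j + d) m
  Λ-vertices zero    d m _     = ≤-reflexive (+-identityʳ (Λ d m))
  Λ-vertices (suc j) d m bound = begin
    r * r ^ j * Λ d m      ≡⟨ *-assoc r (r ^ j) (Λ d m) ⟩
    r * (r ^ j * Λ d m)    ≤⟨ *-monoʳ-≤ r (Λ-vertices j d m bound) ⟩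
    r * Λ (j + d) m        ≤⟨ Λ-vertex (j + d) m (≤-trans bound (pairs-mono j d)) ⟩
    Λ (suc (j + d)) m      ∎
    where open ≤-Reasoning

  Z-empty : ∀ {n} (A : Pred n) (G : Graph n) → card A ≡ 0 → Z A A G ≡ 1
  Z-empty A G empty = trans
    (Z-independent A A G (λ _ Ai → Ai) (λ i _ Ai _ → ⊥-elim (not-¬ (card≡0⇒empty A empty i) Ai)))
    (cong₂ (λ a b → p ^ a * r ^ b) (n≤0⇒n≡0 (subst (card (A ∖ A) ≤_) empty (card-mono {P = A ∖ A} {Q = A} (λ _ → ∧-trueˡ)))) empty)

  Z-dominated : ∀ {n} (A : Pred n) (G : Graph n) (simple : IsSimple G) {v} (Av : A v ≡ true) →
    Dominates A G v → (∀ D → card D < card A → Z D D G ≤ Λ (card D) (edgesIn D G)) →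
    Z A A G ≤ Λ (card A) (edgesIn A G)
  Z-dominated A G simple {v} Av dominated IH = begin
    Z A A G
      ≡⟨ Z-split A A G Av (IsSimple.irrefl simple v) ⟩
    p * Z A' A' G + (if A v then q * Z A' (A' ∖ nbr G v) G else 0)
      ≡⟨ cong (λ a → p * Z A' A' G + (if a then q * Z A' (A' ∖ nbr G v) G else 0)) Av ⟩
    p * Z A' A' G + q * Z A' (A' ∖ nbr G v) G
      ≡⟨ cong₂ (λ x y → p * x + q * y) (Z-isolated A' D G (λ _ → ∧-trueˡ) others-isolated)
                                       (Z-cong G (λ _ → refl) non-nbrs) ⟩
    p * (r ^ c * Z D D G) + q * Z A' (A' ∖ G v) G
      ≡⟨ cong (λ y → p * (r ^ c * Z D D G) + q * y) (Z-independent A' (A' ∖ G v) G (λ _ → ∧-trueˡ) non-nbrs-independent) ⟩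
    p * (r ^ c * Z D D G) + q * (p ^ card (A' ∖ (A' ∖ G v)) * r ^ card (A' ∖ G v))
      ≡⟨ cong₂ (λ a b → p * (r ^ c * Z D D G) + q * (p ^ a * r ^ b)) card-nbrs card-non-nbrs ⟩
    p * (r ^ c * Z D D G) + q * (p ^ d * r ^ c)
      ≤⟨ +-monoˡ-≤ (q * (p ^ d * r ^ c)) (*-monoʳ-≤ p (*-monoʳ-≤ (r ^ c) (IH D card-D<))) ⟩
    p * (r ^ c * Λ d e) + q * (p ^ d * r ^ c)
      ≡⟨ arith p q (r ^ c) (Λ d e) (p ^ d) ⟩
    r ^ c * (p * Λ d e + q * p ^ d)
      ≡⟨ cong (r ^ c *_) (Λ-suc-beyond d e) ⟨
    r ^ c * Λ (suc d) (d + e)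
      ≤⟨ Λ-vertices c (suc d) (d + e) (+-monoʳ-≤ d (edgesIn-≤ D G simple)) ⟩
    Λ (c + suc d) (d + e)
      ≡⟨ cong₂ Λ card-A edgesIn-A ⟩
    Λ (card A) (edgesIn A G) ∎
    where
    open ≤-Reasoning
    open Domination simple Av dominated
    c d e : ℕ
    c = card (A' ∖ D)
    d = card D
    e = edgesIn D G
    arith : ∀ p q R L P → p * (R * L) + q * (P * R) ≡ R * (p * L + q * P)
    arith = solve-∀

  -- Outer induction on |A|; for fixed A and v, shift until v dominates, which terminates because
  -- every shift lowers the number of edges in A ∖ {v}.
  Z-≤-Λ : ∀ {n} (A : Pred n) (G : Graph n) → IsSimple G → Z A A G ≤ Λ (card A) (edgesIn A G)
  Z-≤-Λ {n} A G simple = <-rec P by-size (card A) A G simple refl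
    where
    P : ℕ → Set
    P k = ∀ (A : Pred n) (G : Graph n) → IsSimple G → card A ≡ k → Z A A G ≤ Λ k (edgesIn A G)

    by-size : ∀ k → (∀ {j} → j < k → P j) → P k
    by-size zero    _    A G _      empty = ≤-reflexive (Z-empty A G empty)
    by-size (suc k) IHₖ A G simple count with card≡suc⇒nonempty A count
    ... | v , Av = <-rec Q by-shifting (edgesIn (A ∖ ｛ v ｝) G) G simple refl
      where
      Q : ℕ → Set
      Q t = ∀ (G : Graph n) → IsSimple G → edgesIn (A ∖ ｛ v ｝) G ≡ t → Z A A G ≤ Λ (suc k) (edgesIn A G)

      by-shifting : ∀ t → (∀ {t'} → t' < t → Q t') → Q t
      by-shifting _ IHₜ G simple refl with dominates? A G v
      ... | inj₁ dominated = subst (λ k → Z A A G ≤ Λ k (edgesIn A G)) count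
        (Z-dominated A G simple Av dominated (λ D D<A → IHₖ (subst (card D <_) count D<A) D G simple refl))
      ... | inj₂ (x , y , A'x , A'y , Gxy , Gvy) = begin
        Z A A G                    ≤⟨ Z-shift A Av Ax x≠v G simple ⟩
        Z A A S                    ≤⟨ IHₜ (edgesIn-shift-others A Av Ax y A'y y≠x Gxy Gvy) S shift-isSimple refl ⟩
        Λ (suc k) (edgesIn A S)    ≡⟨ cong (Λ (suc k)) (edgesIn-shift A Av Ax) ⟩
        Λ (suc k) (edgesIn A G)    ∎
        where
        open ≤-Reasoning
        Ax : A x ≡ true
        Ax = ∧-trueˡ A'x
        x≠v : (x == v) ≡ false
        x≠v = removed-≢ A A'x
        y≠x : (y == x) ≡ false
        y≠x with ==-dec y x
        ... | inj₁ refl = ⊥-elim (not-¬ (IsSimple.irrefl simple y) Gxy)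
        ... | inj₂ y≠x  = y≠x
        open Shift {v = v} {u = x} x≠v simple

  unlooped : ∀ {n} → (Fin n → Fin (p + q)) → Vec Bool n
  unlooped φ = Vec.tabulate (λ i → not (toℕ (φ i) <ᵇ p))

  isHom-Sloop : ∀ {n} (G : Graph n) φ → isHom G (Sloop p q) φ ≡ independent G (unlooped φ)
  isHom-Sloop {n} G φ = ⇔→≡ {z = true} (mk⇔
    (λ hom → independent-complete G (unlooped φ) (λ i j τi τj →
      no-edge (G i j) (Equivalence.to (isHom⇔ G (Sloop p q) φ) hom i j)
              (not-true (trans (sym (lookup-unlooped i)) τi)) (not-true (trans (sym (lookup-unlooped j)) τj))))
    (λ ind → Equivalence.from (isHom⇔ G (Sloop p q) φ) (λ i j →
      edge-ok (G i j) (λ ai aj → independent-sound G (unlooped φ) ind i j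
        (trans (lookup-unlooped i) (cong not ai)) (trans (lookup-unlooped j) (cong not aj))))))
    where
    lookup-unlooped : ∀ i → lookup (unlooped φ) i ≡ not (toℕ (φ i) <ᵇ p)
    lookup-unlooped = lookup∘tabulate (λ i → not (toℕ (φ i) <ᵇ p))
    no-edge : ∀ g {a b} → not g ∨ (a ∨ b) ≡ true → a ≡ false → b ≡ false → g ≡ false
    no-edge false _ _ _ = refl
    no-edge true {false} {false} () _ _
    edge-ok : ∀ g {a b} → (a ≡ false → b ≡ false → g ≡ false) → not g ∨ (a ∨ b) ≡ true
    edge-ok false          _ = refl
    edge-ok true  {true}   _ = refl
    edge-ok true  {false} {true}  _ = refl
    edge-ok true  {false} {false} h = ⊥-elim (not-¬ (h refl refl) refl)

  count-maps : ∀ n (h : Vec Bool n → Bool) →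
    length (filterᵇ (h ∘ unlooped) (allMaps n (p + q))) ≡ ∑ᴮ n (λ σ → if h σ then weight full σ else 0)
  count-maps zero h with h []
  ... | true  = refl
  ... | false = refl
  count-maps (suc n) h = begin
    length (filterᵇ (h ∘ unlooped) (allMaps (suc n) (p + q)))
      ≡⟨ length-filterᵇ (h ∘ unlooped) (allMaps (suc n) (p + q)) ⟩
    sumᴸ (map (χ ∘ h ∘ unlooped) (allMaps (suc n) (p + q)))
      ≡⟨ sumᴸ-concatMap (χ ∘ h ∘ unlooped) _ maps ⟩
    _
      ≡⟨ sumᴸ-cong (λ f → per-map f _ (λ _ → refl)) maps ⟩
    sumᴸ (map (λ f → p * χ (h (false ∷ unlooped f)) + q * χ (h (true ∷ unlooped f))) maps)
      ≡⟨ sumᴸ-distrib-+ (λ f → p * χ (h (false ∷ unlooped f))) (λ f → q * χ (h (true ∷ unlooped f))) maps ⟩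
    sumᴸ (map (λ f → p * χ (h (false ∷ unlooped f))) maps) + sumᴸ (map (λ f → q * χ (h (true ∷ unlooped f))) maps)
      ≡⟨ cong₂ _+_ (extend-by p false) (extend-by q true) ⟩
    ∑ᴮ n (λ σ → if h (false ∷ σ) then p * weight full σ else 0) + ∑ᴮ n (λ σ → if h (true ∷ σ) then q * weight full σ else 0) ∎
    where
    open ≡-Reasoning
    maps : List (Fin n → Fin (p + q))
    maps = allMaps n (p + q)
    -- allMaps extends maps by a function local to its definition, hence the abstract ext.
    per-map : ∀ f (ext : Fin (p + q) → Fin (suc n) → Fin (p + q)) →
      (∀ c → unlooped (ext c) ≡ not (toℕ c <ᵇ p) ∷ unlooped f) →
      sumᴸ (map (χ ∘ h ∘ unlooped) (map ext (allFin (p + q)))) ≡ p * χ (h (false ∷ unlooped f)) + q * χ (h (true ∷ unlooped f))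
    per-map f ext ext-law = begin
      sumᴸ (map (χ ∘ h ∘ unlooped) (map ext (allFin (p + q))))
        ≡⟨ trans (sumᴸ-map (χ ∘ h ∘ unlooped) ext (allFin (p + q))) (sumᴸ-allFin (p + q) _) ⟩
      sum {p + q} (λ c → χ (h (unlooped (ext c))))
        ≡⟨ sum-cong-≗ (λ c → cong (χ ∘ h) (ext-law c)) ⟩
      sum {p + q} (λ c → χ (h (not (toℕ c <ᵇ p) ∷ unlooped f)))
        ≡⟨ sum-threshold p (p + q) (λ x → χ (h (x ∷ unlooped f))) ⟩
      (p ⊓ (p + q)) * χ (h (false ∷ unlooped f)) + (p + q ∸ p) * χ (h (true ∷ unlooped f))
        ≡⟨ cong₂ (λ a b → a * χ (h (false ∷ unlooped f)) + b * χ (h (true ∷ unlooped f))) (m≤n⇒m⊓n≡m (m≤m+n p q)) (m+n∸m≡n p q) ⟩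
      p * χ (h (false ∷ unlooped f)) + q * χ (h (true ∷ unlooped f)) ∎
    extend-by : ∀ c x → sumᴸ (map (λ f → c * χ (h (x ∷ unlooped f))) maps)
                       ≡ ∑ᴮ n (λ σ → if h (x ∷ σ) then c * weight full σ else 0)
    extend-by c x = begin
      sumᴸ (map (λ f → c * χ (h (x ∷ unlooped f))) maps)
        ≡⟨ *-distribˡ-sumᴸ c (λ f → χ (h (x ∷ unlooped f))) maps ⟩
      c * sumᴸ (map (λ f → χ (h (x ∷ unlooped f))) maps)
        ≡⟨ cong (c *_) (trans (sym (length-filterᵇ (λ f → h (x ∷ unlooped f)) maps)) (count-maps n (h ∘ (x ∷_)))) ⟩
      c * ∑ᴮ n (λ σ → if h (x ∷ σ) then weight full σ else 0)
        ≡⟨ trans (sym (*-distribˡ-∑ᴮ n c _)) (∑ᴮ-cong n (λ σ → sym (if-then-* (h (x ∷ σ)) c (weight full σ)))) ⟩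
      ∑ᴮ n (λ σ → if h (x ∷ σ) then c * weight full σ else 0) ∎

  hom-Sloop : ∀ {n} (G : Graph n) → hom G (Sloop p q) ≡ Z full full G
  hom-Sloop {n} G = begin
    length (filterᵇ (isHom G (Sloop p q)) (allMaps n (p + q)))
      ≡⟨ length-filterᵇ (isHom G (Sloop p q)) (allMaps n (p + q)) ⟩
    sumᴸ (map (χ ∘ isHom G (Sloop p q)) (allMaps n (p + q)))
      ≡⟨ sumᴸ-cong (λ φ → cong χ (isHom-Sloop G φ)) (allMaps n (p + q)) ⟩
    sumᴸ (map (χ ∘ independent G ∘ unlooped) (allMaps n (p + q)))
      ≡⟨ sym (length-filterᵇ (independent G ∘ unlooped) (allMaps n (p + q))) ⟩
    length (filterᵇ (independent G ∘ unlooped) (allMaps n (p + q)))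
      ≡⟨ count-maps n (independent G) ⟩
    ∑ᴮ n (λ σ → if independent G σ then weight full σ else 0)
      ≡⟨ ∑ᴮ-cong n (λ σ → cong (λ s → if s ∧ independent G σ then weight full σ else 0)
                             (sym (⊆ᵇ-complete σ full (λ _ _ → refl)))) ⟩
    Z full full G ∎
    where open ≡-Reasoning

  Z-head : ∀ {n} (G : Graph (suc n)) → G zero zero ≡ false →
    Z full full G ≡ p * Z full full (tailᴳ G) + q * Z full (λ j → not (nbr G zero (suc j))) (tailᴳ G)
  Z-head {n} G G00 = cong₂ _+_
    (trans (∑ᴮ-cong n (λ σ → if-then-* ((σ ⊆ᵇ full) ∧ independent (tailᴳ G) σ) p (weight full σ))) (*-distribˡ-∑ᴮ n p _))
    (trans (∑ᴮ-cong n with-head) (*-distribˡ-∑ᴮ n q _))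
    where
    with-head : ∀ σ → summand full full G (true ∷ σ) ≡ q * summand full (λ j → not (nbr G zero (suc j))) (tailᴳ G) σ
    with-head σ rewrite G00 | ⊆ᵇ-complete σ full (λ _ _ → refl) =
      if-then-* ((σ ⊆ᵇ λ j → not (nbr G zero (suc j))) ∧ independent (tailᴳ G) σ) q (weight full σ)

  Z-lexGraph : ∀ n m → Z full full (lexGraph n m) ≡ Λ n m
  Z-lexGraph zero    m = refl
  Z-lexGraph (suc n) m = begin
    Z full full L
      ≡⟨ Z-head L refl ⟩
    p * Z full full (tailᴳ L) + q * Z full (λ j → not (nbr L zero (suc j))) (tailᴳ L)
      ≡⟨ cong₂ (λ x y → p * x + q * y) (trans (Z-congᴳ full full _ _ (λ i j _ _ → lexGraph-tail n m i j)) (Z-lexGraph n (m ∸ n)))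
                                       (trans (Z-cong (tailᴳ L) (λ _ → refl) (λ j → cong not (lexGraph-head n m j)))
                                              (Z-congᴳ full later _ _ (λ i j _ _ → lexGraph-tail n m i j))) ⟩
    p * Λ n (m ∸ n) + q * Z full later (lexGraph n (m ∸ n))
      ≡⟨ cong (λ x → p * Λ n (m ∸ n) + q * x) (Z-independent full later _ (λ _ _ → refl) later-independent) ⟩
    p * Λ n (m ∸ n) + q * (p ^ card (full ∖ later) * r ^ card later)
      ≡⟨ cong₂ (λ a b → p * Λ n (m ∸ n) + q * (p ^ a * r ^ b)) earlier-count later-count ⟩
    Λ (suc n) m ∎
    where
    open ≡-Reasoning
    L : Graph (suc n)
    L = lexGraph (suc n) m
    later : Pred n
    later j = not (toℕ j <ᵇ m)
    later-independent : ∀ i j → later i ≡ true → later j ≡ true → lexGraph n (m ∸ n) i j ≡ false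
    later-independent i j later-i _ =
      subst (λ k → lexGraph n k i j ≡ false) (sym (m≤n⇒m∸n≡0 (≤-trans (m≤i (toℕ i) m later-i) (<⇒≤ (toℕ<n i)))))
            (lexGraph-edgeless n i j)
      where
      m≤i : ∀ a m → not (a <ᵇ m) ≡ true → m ≤ a
      m≤i a       zero    _ = z≤n
      m≤i (suc a) (suc m) h = s≤s (m≤i a m h)
    earlier-count : card (full ∖ later) ≡ m ⊓ n
    earlier-count = begin
      card (full ∖ later)
        ≡⟨ sum-threshold m n (χ ∘ not) ⟩
      (m ⊓ n) * 1 + (n ∸ m) * 0
        ≡⟨ cong₂ _+_ (*-identityʳ (m ⊓ n)) (*-zeroʳ (n ∸ m)) ⟩
      m ⊓ n + 0
        ≡⟨ +-identityʳ (m ⊓ n) ⟩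
      m ⊓ n ∎
    later-count : card later ≡ n ∸ m
    later-count = begin
      card later
        ≡⟨ sum-threshold m n χ ⟩
      (m ⊓ n) * 0 + (n ∸ m) * 1
        ≡⟨ cong₂ _+_ (*-zeroʳ (m ⊓ n)) (*-identityʳ (n ∸ m)) ⟩
      n ∸ m ∎

corollary2p7 : (p q : ℕ) → 1 ≤ p → 1 ≤ q → (n m : ℕ) → (G : Graph n) → IsSimple G →
    edgeCount G ≡ m → hom G (Sloop p q) ≤ hom (lexGraph n m) (Sloop p q)
corollary2p7 p q _ _ n m G simple edges = begin
  hom G (Sloop p q)                     ≡⟨ hom-Sloop p q G ⟩
  Z p q full full G                     ≤⟨ Z-≤-Λ p q full G simple ⟩
  Λ p q (card (full {n})) (edgesIn full G) ≡⟨ cong₂ (Λ p q) (card-full n) (trans (sym (edgeCount≡edgesIn G)) edges) ⟩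
  Λ p q n m                             ≡⟨ Z-lexGraph p q n m ⟨
  Z p q full full (lexGraph n m)        ≡⟨ hom-Sloop p q (lexGraph n m) ⟨
  hom (lexGraph n m) (Sloop p q)        ∎
  where open ≤-Reasoning
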